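{- Let $K=\mathbb{F}((t))$ with $\mathbb{F}$ a finite field of characteristic $p$ or $\overline{\mathbb{F}}_p$, let $\beta\in K$ with $v_K(\beta)=-b$, $b>0$, $\gcd(b,p)=1$, and let $\Omega_0,\dots,\Omega_n\in K$ satisfy the conditions in the context. Then for $0\le i<j\le n$, $$v_K(\Omega_j^{(i)})=-p^i\sum_{k=i+1}^{j}m_k,$$ where $m_k=v_K(\Omega_{k-1})-v_K(\Omega_k)$.
   Context: $v_K$ is the normalized valuation, $\mathfrak O_K,\mathfrak P_K$ the valuation ring and maximal ideal, $\wp(x)=x^p-x$, $\phi(x)=x^p$. Conditions: $\Omega_0,\dots,\Omega_n$ are linearly independent over $\mathbb{F}_p$, $\Omega_0=1$, $v_K(\Omega_n)\le\cdots\le v_K(\Omega_1)\le v_K(\Omega_0)=0$, and whenever $v_K(\Omega_i)=\cdots=v_K(\Omega_j)$ with $i<j$, the images of $\phi^n(\Omega_i)\beta,\dots,\phi^n(\Omega_j)\beta$ in $\phi^n(\Omega_i)\beta\mathfrak O_K/\phi^n(\Omega_i)\beta\mathfrak P_K$ are linearly independent over $\mathbb{F}_p$. Define $\Omega_j^{(0)}=\Omega_j$ and recursively $\Omega_j^{(i)}=\wp(\Omega_j^{(i-1)})/\wp(\Omega_i^{(i-1)})$ for $1\le i\le j\le n$. -}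

module Defs where

open import Level using (Level; _⊔_)
open import Algebra.Bundles using (CommutativeRing)
open import Data.Nat as ℕ using (ℕ; zero; suc; _∸_)
open import Data.Integer as ℤ using (ℤ; +_; -[1+_])
open import Data.List using (List; []; _∷_; foldr; map; applyUpTo; _++_; [_])
open import Data.List.Relation.Unary.Any using (Any)
open import Data.Product using (Σ; _×_)
open import Data.Sum using (_⊎_)
open import Data.Empty.Polymorphic using (⊥)
open import Data.Fin using (Fin; toℕ)
open import Relation.Nullary using (¬_)
open import Relation.Binary.PropositionalEquality using (_≢_)

-- The list [a, a+1, ..., b]  (empty if b < a)
rangeFT : ℕ → ℕ → List ℕ
rangeFT a b = applyUpTo (a ℕ.+_) (suc b ∸ a)

sumℤ : ℕ → ℕ → (ℕ → ℤ) → ℤ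
sumℤ a b f = foldr ℤ._+_ (+ 0) (map f (rangeFT a b))

module OverRing {c ℓ : Level} (F : CommutativeRing c ℓ) where
  open CommutativeRing F

  _·F_ : ℕ → Carrier → Carrier
  zero ·F x = 0#
  suc n ·F x = x + (n ·F x)

  record IsField : Set (c ⊔ ℓ) where
    field
      nontrivial : ¬ (1# ≈ 0#)
      inverse    : ∀ x → ¬ (x ≈ 0#) → Σ Carrier (λ y → (x * y) ≈ 1#)

  -- p · 1 = 0 in F  (together with p prime and F a field: char F = p)
  HasChar : ℕ → Set ℓ
  HasChar p = (p ·F 1#) ≈ 0#

  Elem : Carrier → List Carrier → Set (c ⊔ ℓ)
  Elem x [] = ⊥
  Elem x (y ∷ ys) = (x ≈ y) ⊎ Elem x ys

  IsFinite : Set (c ⊔ ℓ)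
  IsFinite = Σ (List Carrier) (λ xs → ∀ x → Elem x xs)

  -- value at x of the polynomial  Σ_i cs_i X^i  (lowest degree first)
  evalPoly : List Carrier → Carrier → Carrier
  evalPoly [] x = 0#
  evalPoly (a ∷ as) x = a + (x * evalPoly as x)

  -- every element of F is algebraic over the prime field F_p = {k·1 : k < p}:
  -- it is a root of a nonzero polynomial with coefficients in F_p
  AlgebraicOverPrimeField : ℕ → Set (c ⊔ ℓ)
  AlgebraicOverPrimeField p =
    ∀ x → Σ (List (Fin p)) (λ cs →
            Any (λ k → toℕ k ≢ 0) cs
          × (evalPoly (map (λ k → toℕ k ·F 1#) cs) x ≈ 0#))

  -- every monic polynomial of degree ≥ 1 over F has a root in F
  AlgebraicallyClosed : Set (c ⊔ ℓ)
  AlgebraicallyClosed =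
    ∀ (a : Carrier) (cs : List Carrier) →
      Σ Carrier (λ x → evalPoly (a ∷ (cs ++ [ 1# ])) x ≈ 0#)

  IsAlgClosureOfFp : ℕ → Set (c ⊔ ℓ)
  IsAlgClosureOfFp p = AlgebraicOverPrimeField p × AlgebraicallyClosed

  -- K = F((t)): the Laurent series  t^ord · Σ_{n ≥ 0} co n · t^n

  record K : Set c where
    constructor laurent
    field
      ord : ℤ
      co  : ℕ → Carrier
  open K public

  coeff : K → ℤ → Carrier
  coeff x k with k ℤ.- ord x
  ... | + n = co x n
  ... | -[1+ _ ] = 0#

  infix 4 _≈K_
  _≈K_ : K → K → Set ℓ
  x ≈K y = ∀ k → coeff x k ≈ coeff y k

  0K : K
  0K = laurent (+ 0) (λ _ → 0#)

  1K : K
  1K = laurent (+ 0) (λ { zero → 1# ; (suc _) → 0# })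

  infixl 6 _+K_ _-K_
  infixl 7 _*K_

  _+K_ : K → K → K
  x +K y = laurent o (λ n → coeff x (o ℤ.+ + n) + coeff y (o ℤ.+ + n))
    where o = ord x ℤ.⊓ ord y

  -K_ : K → K
  -K x = laurent (ord x) (λ n → - co x n)

  _-K_ : K → K → K
  x -K y = x +K (-K y)

  sumF : ℕ → ℕ → (ℕ → Carrier) → Carrier
  sumF a b f = foldr _+_ 0# (map f (rangeFT a b))

  _*K_ : K → K → K
  x *K y = laurent (ord x ℤ.+ ord y)
                   (λ n → sumF 0 n (λ i → co x i * co y (n ∸ i)))

  powK : K → ℕ → K
  powK x zero = 1K
  powK x (suc n) = x *K powK x n

  φ^ : ℕ → ℕ → K → K
  φ^ p n x = powK x (p ℕ.^ n)

  ℘ : ℕ → K → K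
  ℘ p x = powK x p -K x

  _·K_ : ℕ → K → K
  zero ·K x = 0K
  suc n ·K x = x +K (n ·K x)

  sumK : ℕ → ℕ → (ℕ → K) → K
  sumK a b f = foldr _+K_ 0K (map f (rangeFT a b))

  -- v_K(x) = m  (in particular x ≠ 0)
  HasVal : K → ℤ → Set ℓ
  HasVal x m = (∀ k → k ℤ.< m → coeff x k ≈ 0#) × ¬ (coeff x m ≈ 0#)

  -- u ∈ 𝔓_K, i.e. v_K(u) ≥ 1
  In𝔓 : K → Set ℓ
  In𝔓 u = ∀ k → k ℤ.≤ + 0 → coeff u k ≈ 0#

  InMul𝔓 : K → K → Set (c ⊔ ℓ)
  InMul𝔓 z y = Σ K (λ u → In𝔓 u × (y ≈K z *K u))

-- By induction on i: for i ≤ j ≤ n the series Ω_j^{(i)} has valuation p^i (v(Ω_j) − v(Ω_i)), and on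
-- every block i ≤ l ≤ e of equal valuations v(Ω_l) = v(Ω_i) the leading coefficients of the Ω_l^{(i)}
-- are linearly independent over 𝔽ₚ, the one of Ω_i^{(i)} being 1. The map ℘ multiplies a negative
-- valuation by p and raises the leading coefficient to the p-th power; on a series of valuation 0 it
-- applies ℘ to the constant term, which cannot vanish since the constant terms of a block are
-- independent and contain 1 (the roots of X^p − X are exactly 𝔽ₚ). Dividing by ℘(Ω_{i+1}^{(i)})
-- gives the valuations at level i + 1. Where a new block starts, its leading coefficients are
-- proportional to the p^i-th powers of those of the Ω_l, and the residue condition, carried over by
-- Frobenius, gives their independence. Finally the valuations telescope to the stated sum.

module Submission where

open import Defs
open import Level using (Level; _⊔_)
open import Function using (_∘_)
open import Data.Empty using (⊥-elim)
open import Data.Unit using (⊤; tt)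
open import Data.Product using (Σ; ∃-syntax; _,_; proj₁; proj₂) renaming (_×_ to _×ᵖ_)
open import Data.Sum using (_⊎_; inj₁; inj₂)
open import Relation.Nullary using (¬_; yes; no)
open import Relation.Nullary.Decidable using (decidable-stable)
open import Relation.Binary.Definitions using (Tri; tri<; tri≈; tri>)
open import Relation.Binary.PropositionalEquality as ≡ using (_≡_; _≢_)

open import Data.Nat as ℕ using (ℕ; zero; suc; _∸_; _<_; _≤_; z≤n; s≤s; _!)
import Data.Nat.Properties as ℕP
open import Data.Nat.Induction using (<-rec; <-wellFounded)
open import Data.Nat.Primality using (Prime; euclidsLemma; ¬prime[1]; prime⇒nonZero; prime⇒nonTrivial)
open import Data.Nat.Divisibility using (_∣_; _∤_; divides; ∣1⇒≡1; ∣⇒≤; m∣m*n)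
open import Data.Nat.Combinatorics using (_C_; nCn≡1; nCk≡n!/k![n-k]!; k![n∸k]!∣n!)
open import Data.Nat.DivMod using (m/n*n≡m)
open import Data.Nat.Coprimality using (prime⇒coprime; coprime⇒GCD≡1)
open import Data.Nat.GCD using (gcd; module Bézout)
open import Data.Integer as ℤ using (ℤ; +_; -[1+_])
import Data.Integer.Properties as ℤP
open import Data.Integer.Solver using (module +-*-Solver)
open +-*-Solver using (_:=_; _:+_; _:-_; _:*_; :-_; con) renaming (solve to ℤsolve)
import Algebra.Properties.AbelianGroup ℤP.+-0-abelianGroup as ℤG
open import Data.Fin as Fin using (toℕ; fromℕ)
import Data.Fin.Properties as FinP
open import Data.Vec using (Vec; []; _∷_; replicate)
open import Data.Vec.Functional using (Vector; tail)
open import Data.List using ([]; _∷_; foldr; map; applyUpTo)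
open import Induction.WellFounded as WF using (WfRec; module FixPoint)

open import Algebra.Bundles using (CommutativeRing)
open import Algebra.Morphism.Structures using (module MonoidMorphisms)

prime∤! : ∀ {p} → Prime p → ∀ m → m < p → p ∤ m !
prime∤! pr zero    _   p∣1 = ¬prime[1] (≡.subst Prime (∣1⇒≡1 p∣1) pr)
prime∤! pr (suc m) m<p p∣m! with euclidsLemma (suc m) (m !) pr p∣m!
... | inj₁ p∣m+1 = ℕP.<⇒≱ m<p (∣⇒≤ p∣m+1)
... | inj₂ p∣m!′ = prime∤! pr m (ℕP.<-trans (ℕP.n<1+n m) m<p) p∣m!′

prime∣C : ∀ {p} → Prime p → ∀ k → 0 < k → k < p → p ∣ p C k
prime∣C {p} pr k 0<k k<p with euclidsLemma (p C k) (k ! ℕ.* (p ∸ k) !) pr p∣C·k!·[p-k]!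
  where
    instance
      _ = prime⇒nonZero pr
      _ = ℕP._!*_!≢0 k (p ∸ k)
    p∣C·k!·[p-k]! : p ∣ (p C k) ℕ.* (k ! ℕ.* (p ∸ k) !)
    p∣C·k!·[p-k]! = ≡.subst (p ∣_) (≡.sym (begin
      (p C k) ℕ.* (k ! ℕ.* (p ∸ k) !)                ≡⟨ ≡.cong (ℕ._* (k ! ℕ.* (p ∸ k) !)) (nCk≡n!/k![n-k]! (ℕP.<⇒≤ k<p)) ⟩
      (p ! ℕ./ (k ! ℕ.* (p ∸ k) !)) ℕ.* (k ! ℕ.* (p ∸ k) !)  ≡⟨ m/n*n≡m (k![n∸k]!∣n! (ℕP.<⇒≤ k<p)) ⟩
      p ! ∎))
      (≡.subst (λ q → q ∣ q !) (ℕP.suc-pred p) (m∣m*n (ℕ.pred p !)))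
      where open ≡.≡-Reasoning
... | inj₁ p∣C = p∣C
... | inj₂ p∣k!·[p-k]! with euclidsLemma (k !) ((p ∸ k) !) pr p∣k!·[p-k]!
...   | inj₁ p∣k! = ⊥-elim (prime∤! pr k k<p p∣k!)
...   | inj₂ p∣[p-k]! = ⊥-elim (prime∤! pr (p ∸ k) (ℕP.∸-monoʳ-< {o = 0} 0<k (ℕP.<⇒≤ k<p)) p∣[p-k]!)

_[_]≔_ : (ℕ → ℕ) → ℕ → ℕ → ℕ → ℕ
(k [ i ]≔ v) l with l ℕ.≟ i
... | yes _ = v
... | no  _ = k l

[]≔-updated : ∀ k i v → (k [ i ]≔ v) i ≡ v
[]≔-updated k i v rewrite ℕP.≟-diag (≡.refl {x = i}) = ≡.refl

[]≔-unchanged : ∀ k {i} v {l} → l ≢ i → (k [ i ]≔ v) l ≡ k l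
[]≔-unchanged k {i} v {l} l≢i with l ℕ.≟ i
... | yes l≡i = ⊥-elim (l≢i l≡i)
... | no  _   = ≡.refl

i≤j⇒j≡i+n : ∀ {i j} → i ℤ.≤ j → ∃[ n ] j ≡ i ℤ.+ + n
i≤j⇒j≡i+n {i} {j} i≤j with j ℤ.- i | ℤP.i≤j⇒0≤j-i i≤j | ℤsolve 2 (λ i j → j := i :+ (j :- i)) ≡.refl i j
... | + n | _ | j≡i+[j-i] = n , j≡i+[j-i]

i+j<k+l⇒i<k⊎j<l : ∀ {i j k l} → i ℤ.+ j ℤ.< k ℤ.+ l → i ℤ.< k ⊎ j ℤ.< l
i+j<k+l⇒i<k⊎j<l {i} {j} {k} {l} i+j<k+l with i ℤ.<? k | j ℤ.<? l
... | yes i<k | _       = inj₁ i<k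
... | no  _   | yes j<l = inj₂ j<l
... | no  i≮k | no  j≮l = ⊥-elim (ℤP.<⇒≱ i+j<k+l (ℤP.+-mono-≤ (ℤP.≮⇒≥ i≮k) (ℤP.≮⇒≥ j≮l)))

i+j≡k+l∧k<i⇒j<l : ∀ {i j k l} → i ℤ.+ j ≡ k ℤ.+ l → k ℤ.< i → j ℤ.< l
i+j≡k+l∧k<i⇒j<l {i} {j} {k} {l} i+j≡k+l k<i with j ℤ.<? l
... | yes j<l = j<l
... | no  j≮l = ⊥-elim (ℤP.<⇒≢ (ℤP.+-mono-<-≤ k<i (ℤP.≮⇒≥ j≮l)) (≡.sym i+j≡k+l))

+-cancelˡ-< : ∀ i {j k} → i ℤ.+ j ℤ.< i ℤ.+ k → j ℤ.< k
+-cancelˡ-< i {j} {k} i+j<i+k with j ℤ.<? k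
... | yes j<k = j<k
... | no  j≮k = ⊥-elim (ℤP.<⇒≱ i+j<i+k (ℤP.+-monoʳ-≤ i (ℤP.≮⇒≥ j≮k)))

+-cancelˡ-≡ : ∀ i {j k} → i ℤ.+ j ≡ i ℤ.+ k → j ≡ k
+-cancelˡ-≡ i = ℤG.∙-cancelˡ i _ _

<-suc⇒≤ : ∀ {i j} → i ℤ.< ℤ.suc j → i ℤ.≤ j
<-suc⇒≤ {i} {j} i<1+j = ≡.subst (i ℤ.≤_) (ℤP.pred-suc j) (ℤP.i<j⇒i≤pred[j] i<1+j)

[i+m]+[j+[n∸m]]≡[i+j]+n : ∀ i j {m n} → m ≤ n → (i ℤ.+ + m) ℤ.+ (j ℤ.+ + (n ∸ m)) ≡ (i ℤ.+ j) ℤ.+ + n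
[i+m]+[j+[n∸m]]≡[i+j]+n i j {m} {n} m≤n = begin
  (i ℤ.+ + m) ℤ.+ (j ℤ.+ + (n ∸ m))  ≡⟨ ℤsolve 4 (λ i j m k → (i :+ m) :+ (j :+ k) := (i :+ j) :+ (m :+ k)) ≡.refl i j (+ m) (+ (n ∸ m)) ⟩
  (i ℤ.+ j) ℤ.+ (+ m ℤ.+ + (n ∸ m))  ≡⟨ ≡.cong (λ k → (i ℤ.+ j) ℤ.+ + k) (ℕP.m+[n∸m]≡n m≤n) ⟩
  (i ℤ.+ j) ℤ.+ + n ∎
  where open ≡.≡-Reasoning

module FiniteSums {c ℓ} (R : CommutativeRing c ℓ) where
  open CommutativeRing R
  open OverRing R using (sumF)
  open MonoidMorphisms +-rawMonoid +-rawMonoid using (IsMonoidHomomorphism)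
  open import Algebra.Properties.Monoid.Mult +-monoid using (_×_; ×-congʳ)
  open import Algebra.Properties.CommutativeSemigroup +-commutativeSemigroup using (interchange)
  open import Algebra.Properties.Ring ring using (-‿+-comm; -0#≈0#)
  open import Relation.Binary.Reasoning.Setoid setoid

  ∑ : ℕ → (ℕ → Carrier) → Carrier
  ∑ zero    g = 0#
  ∑ (suc n) g = g 0 + ∑ n (g ∘ suc)

  ∑-cong : ∀ n {g h} → (∀ i → i < n → g i ≈ h i) → ∑ n g ≈ ∑ n h
  ∑-cong zero    g≈h = refl
  ∑-cong (suc n) g≈h = +-cong (g≈h 0 (s≤s z≤n)) (∑-cong n (λ i i<n → g≈h (suc i) (s≤s i<n)))

  ∑-cong-≡ : ∀ n {g h} → (∀ i → g i ≡ h i) → ∑ n g ≡ ∑ n h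
  ∑-cong-≡ zero    g≡h = ≡.refl
  ∑-cong-≡ (suc n) g≡h = ≡.cong₂ _+_ (g≡h 0) (∑-cong-≡ n (g≡h ∘ suc))

  ∑-zero : ∀ n {g} → (∀ i → i < n → g i ≈ 0#) → ∑ n g ≈ 0#
  ∑-zero zero    g≈0 = refl
  ∑-zero (suc n) g≈0 = trans (+-cong (g≈0 0 (s≤s z≤n)) (∑-zero n (λ i i<n → g≈0 (suc i) (s≤s i<n))))
                             (+-identityˡ 0#)

  ∑-single : ∀ n {g} i → i < n → (∀ j → j < n → j ≢ i → g j ≈ 0#) → ∑ n g ≈ g i
  ∑-single (suc n) {g} zero _ g≈0 =
    trans (+-congˡ (∑-zero n (λ j j<n → g≈0 (suc j) (s≤s j<n) (λ ())))) (+-identityʳ (g 0))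
  ∑-single (suc n) (suc i) (s≤s i<n) g≈0 =
    trans (+-congʳ (g≈0 0 (s≤s z≤n) (λ ())))
      (trans (+-identityˡ _)
             (∑-single n i i<n (λ j j<n j≢i → g≈0 (suc j) (s≤s j<n) (j≢i ∘ ℕP.suc-injective))))

  ∑-+-split : ∀ m n g → ∑ (m ℕ.+ n) g ≈ ∑ m g + ∑ n (λ i → g (m ℕ.+ i))
  ∑-+-split zero    n g = sym (+-identityˡ _)
  ∑-+-split (suc m) n g = trans (+-congˡ (∑-+-split m n (g ∘ suc))) (sym (+-assoc _ _ _))

  ∑-telescope : ∀ n (f : ℕ → Carrier) → ∑ n (λ i → f i - f (suc i)) ≈ f 0 - f n
  ∑-telescope zero    f = sym (-‿inverseʳ (f 0))
  ∑-telescope (suc n) f = begin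
    (f 0 - f 1) + ∑ n (λ i → f (suc i) - f (suc (suc i)))  ≈⟨ +-congˡ (∑-telescope n (f ∘ suc)) ⟩
    (f 0 - f 1) + (f 1 - f (suc n))                         ≈⟨ +-assoc (f 0) (- f 1) _ ⟩
    f 0 + (- f 1 + (f 1 - f (suc n)))                       ≈⟨ +-congˡ (sym (+-assoc (- f 1) (f 1) _)) ⟩
    f 0 + ((- f 1 + f 1) - f (suc n))                       ≈⟨ +-congˡ (+-congʳ (-‿inverseˡ (f 1))) ⟩
    f 0 + (0# - f (suc n))                                  ≈⟨ +-congˡ (+-identityˡ _) ⟩
    f 0 - f (suc n) ∎

  foldr-map-applyUpTo : ∀ (f : ℕ → Carrier) g n →
                        foldr _+_ 0# (map f (applyUpTo g n)) ≡ ∑ n (f ∘ g)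
  foldr-map-applyUpTo f g zero    = ≡.refl
  foldr-map-applyUpTo f g (suc n) = ≡.cong (_+_ (f (g 0))) (foldr-map-applyUpTo f (g ∘ suc) n)

  ×-zeroʳ : ∀ n → n × 0# ≈ 0#
  ×-zeroʳ zero    = refl
  ×-zeroʳ (suc n) = trans (+-identityˡ _) (×-zeroʳ n)

  sumF-∑ : ∀ a b f → sumF a b f ≡ ∑ (suc b ∸ a) (λ i → f (a ℕ.+ i))
  sumF-∑ a b f = foldr-map-applyUpTo f (a ℕ.+_) (suc b ∸ a)

  private
    a+i≤b : ∀ {a b i} → i < suc b ∸ a → a ℕ.+ i ≤ b
    a+i≤b {a} {b} {i} i<1+b-a with a ℕP.≤? suc b
    ... | yes a≤1+b = ℕP.≤-pred (≡.subst (_≤ suc b) (≡.cong suc (ℕP.+-comm i a)) (ℕP.m≤o∸n⇒m+n≤o (suc i) a≤1+b i<1+b-a))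
    ... | no  a≰1+b = ⊥-elim (ℕP.n≮0 (≡.subst (i <_) (ℕP.m≤n⇒m∸n≡0 (ℕP.<⇒≤ (ℕP.≰⇒> a≰1+b))) i<1+b-a))

  sumF-cong : ∀ a b {f g} → (∀ l → a ≤ l → l ≤ b → f l ≈ g l) → sumF a b f ≈ sumF a b g
  sumF-cong a b {f} {g} f≈g = begin
    sumF a b f                       ≡⟨ sumF-∑ a b f ⟩
    ∑ (suc b ∸ a) (λ i → f (a ℕ.+ i)) ≈⟨ ∑-cong (suc b ∸ a) (λ i i< → f≈g (a ℕ.+ i) (ℕP.m≤m+n a i) (a+i≤b i<)) ⟩
    ∑ (suc b ∸ a) (λ i → g (a ℕ.+ i)) ≡⟨ sumF-∑ a b g ⟨
    sumF a b g ∎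

  sumF-zero : ∀ a b {f} → (∀ l → a ≤ l → l ≤ b → f l ≈ 0#) → sumF a b f ≈ 0#
  sumF-zero a b {f} f≈0 = trans (sumF-cong a b f≈0) (trans (reflexive (sumF-∑ a b _)) (∑-zero (suc b ∸ a) (λ _ _ → refl)))

  sumF-head : ∀ a b f → a ≤ b → sumF a b f ≈ f a + sumF (suc a) b f
  sumF-head a b f a≤b = begin
    sumF a b f                                       ≡⟨ sumF-∑ a b f ⟩
    ∑ (suc b ∸ a) (λ i → f (a ℕ.+ i))                ≡⟨ ≡.cong (λ m → ∑ m (λ i → f (a ℕ.+ i))) (ℕP.+-∸-assoc 1 a≤b) ⟩
    f (a ℕ.+ 0) + ∑ (b ∸ a) (λ i → f (a ℕ.+ suc i))  ≈⟨ +-cong (reflexive (≡.cong f (ℕP.+-identityʳ a)))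
                                                          (∑-cong (b ∸ a) (λ i _ → reflexive (≡.cong f (ℕP.+-suc a i)))) ⟩
    f a + ∑ (b ∸ a) (λ i → f (suc a ℕ.+ i))          ≡⟨ ≡.cong (_+_ (f a)) (sumF-∑ (suc a) b f) ⟨
    f a + sumF (suc a) b f ∎

  sumF-single : ∀ a b j f → a ≤ j → j ≤ b → (∀ l → a ≤ l → l ≤ b → l ≢ j → f l ≈ 0#) → sumF a b f ≈ f j
  sumF-single a b j f a≤j j≤b f≈0 = begin
    sumF a b f                         ≡⟨ sumF-∑ a b f ⟩
    ∑ (suc b ∸ a) (λ i → f (a ℕ.+ i))  ≈⟨ ∑-single (suc b ∸ a) (j ∸ a) j-a<1+b-a
                                            (λ i i< i≢ → f≈0 (a ℕ.+ i) (ℕP.m≤m+n a i) (a+i≤b i<)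
                                                           (λ a+i≡j → i≢ (≡.trans (≡.sym (ℕP.m+n∸m≡n a i)) (≡.cong (_∸ a) a+i≡j)))) ⟩
    f (a ℕ.+ (j ∸ a))                  ≡⟨ ≡.cong f (ℕP.m+[n∸m]≡n a≤j) ⟩
    f j ∎
    where
      j-a<1+b-a : j ∸ a < suc b ∸ a
      j-a<1+b-a = ≡.subst (j ∸ a <_) (≡.sym (ℕP.+-∸-assoc 1 (ℕP.≤-trans a≤j j≤b))) (s≤s (ℕP.∸-monoˡ-≤ a j≤b))

  lincomb : (ℕ → ℕ) → (ℕ → Carrier) → ℕ → ℕ → Carrier
  lincomb k g a b = sumF a b (λ l → k l × g l)

  Additive : (Carrier → Carrier) → Set (c ⊔ ℓ)
  Additive = IsMonoidHomomorphism

  module _ {f : Carrier → Carrier} (additive : Additive f) where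
    open IsMonoidHomomorphism additive using (homo; ε-homo)

    additive-× : ∀ k x → f (k × x) ≈ k × f x
    additive-× zero    x = ε-homo
    additive-× (suc k) x = trans (homo x (k × x)) (+-congˡ (additive-× k x))

    additive-∑ : ∀ n g → f (∑ n g) ≈ ∑ n (f ∘ g)
    additive-∑ zero    g = ε-homo
    additive-∑ (suc n) g = trans (homo (g 0) (∑ n (g ∘ suc))) (+-congˡ (additive-∑ n (g ∘ suc)))

    additive-sumF : ∀ a b g → f (sumF a b g) ≈ sumF a b (f ∘ g)
    additive-sumF a b g = begin
      f (sumF a b g)                          ≡⟨ ≡.cong f (sumF-∑ a b g) ⟩
      f (∑ (suc b ∸ a) (λ i → g (a ℕ.+ i)))  ≈⟨ additive-∑ (suc b ∸ a) _ ⟩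
      ∑ (suc b ∸ a) (λ i → f (g (a ℕ.+ i)))  ≡⟨ sumF-∑ a b (f ∘ g) ⟨
      sumF a b (f ∘ g) ∎

    additive-lincomb : ∀ k g a b → f (lincomb k g a b) ≈ lincomb k (f ∘ g) a b
    additive-lincomb k g a b =
      trans (additive-sumF a b _) (sumF-cong a b (λ l _ _ → additive-× (k l) (g l)))

  *-additiveʳ : ∀ x → Additive (_* x)
  *-additiveʳ x = record
    { isMagmaHomomorphism = record
      { isRelHomomorphism = record { cong = *-congʳ }
      ; homo = λ y z → distribʳ x y z }
    ; ε-homo = zeroˡ x }

  additive-- : ∀ {f g} → Additive f → Additive g → Additive (λ x → f x - g x)
  additive-- {f} {g} f-add g-add = record
    { isMagmaHomomorphism = record
      { isRelHomomorphism = record { cong = λ x≈y → +-cong (F.⟦⟧-cong x≈y) (-‿cong (G.⟦⟧-cong x≈y)) }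
      ; homo = λ x y → begin
          f (x + y) - g (x + y)          ≈⟨ +-cong (F.homo x y) (-‿cong (G.homo x y)) ⟩
          (f x + f y) - (g x + g y)      ≈⟨ +-congˡ (sym (-‿+-comm (g x) (g y))) ⟩
          (f x + f y) + (- g x + - g y)  ≈⟨ interchange (f x) (f y) (- g x) (- g y) ⟩
          (f x - g x) + (f y - g y) ∎ }
    ; ε-homo = trans (+-cong F.ε-homo (trans (-‿cong G.ε-homo) -0#≈0#)) (+-identityʳ 0#) }
    where
      module F = IsMonoidHomomorphism f-add
      module G = IsMonoidHomomorphism g-add

  id-additive : Additive (λ x → x)
  id-additive = record
    { isMagmaHomomorphism = record { isRelHomomorphism = record { cong = λ x≈y → x≈y } ; homo = λ _ _ → refl }
    ; ε-homo = refl }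

sumℤ-telescope : ∀ (f : ℕ → ℤ) {i j} → i ≤ j → sumℤ (suc i) j (λ k → f (k ∸ 1) ℤ.- f k) ≡ f i ℤ.- f j
sumℤ-telescope f {i} {j} i≤j = begin
  sumℤ (suc i) j (λ k → f (k ∸ 1) ℤ.- f k)                   ≡⟨ ℤΣ.sumF-∑ (suc i) j _ ⟩
  ℤΣ.∑ (j ∸ i) (λ t → f (i ℕ.+ t) ℤ.- f (suc (i ℕ.+ t)))      ≡⟨ ℤΣ.∑-cong-≡ (j ∸ i) (λ t → ≡.cong (λ m → f (i ℕ.+ t) ℤ.- f m) (≡.sym (ℕP.+-suc i t))) ⟩
  ℤΣ.∑ (j ∸ i) (λ t → f (i ℕ.+ t) ℤ.- f (i ℕ.+ suc t))        ≡⟨ ℤΣ.∑-telescope (j ∸ i) (λ t → f (i ℕ.+ t)) ⟩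
  f (i ℕ.+ 0) ℤ.- f (i ℕ.+ (j ∸ i))                           ≡⟨ ≡.cong₂ (λ m m′ → f m ℤ.- f m′) (ℕP.+-identityʳ i) (ℕP.m+[n∸m]≡n i≤j) ⟩
  f i ℤ.- f j ∎
  where
    open ≡.≡-Reasoning
    module ℤΣ = FiniteSums ℤP.+-*-commutativeRing

module CharacteristicP {c ℓ} (R : CommutativeRing c ℓ) {p : ℕ} (p-prime : Prime p) (char : OverRing.HasChar R p) where
  open CommutativeRing R
  open OverRing R using (_·F_)
  open FiniteSums R
  open import Algebra.Properties.Monoid.Mult +-monoid using (_×_; ×-congʳ; ×-assocˡ; ×-homo-+)
  open import Algebra.Properties.Semiring.Mult semiring using (×-assoc-*)
  open import Algebra.Properties.Semiring.Exp semiring using (_^_; ^-congˡ; ^-assocʳ)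
  open import Algebra.Definitions.RawMonoid +-rawMonoid using (sum)
  import Algebra.Properties.CommutativeSemiring.Binomial commutativeSemiring as Binomial
  open import Relation.Binary.Reasoning.Setoid setoid

  instance
    p-nonZero : ℕ.NonZero p
    p-nonZero = prime⇒nonZero p-prime

  ·F≡× : ∀ n x → n ·F x ≡ n × x
  ·F≡× zero    x = ≡.refl
  ·F≡× (suc n) x = ≡.cong (_+_ x) (·F≡× n x)

  ×≈×1* : ∀ n x → n × x ≈ (n × 1#) * x
  ×≈×1* n x = trans (×-congʳ n (sym (*-identityˡ x))) (sym (×-assoc-* n 1# x))

  p×x≈0 : ∀ x → p × x ≈ 0#
  p×x≈0 x = begin
    p × x          ≈⟨ ×≈×1* p x ⟩
    (p × 1#) * x   ≡⟨ ≡.cong (_* x) (≡.sym (·F≡× p 1#)) ⟩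
    (p ·F 1#) * x  ≈⟨ *-congʳ char ⟩
    0# * x         ≈⟨ zeroˡ x ⟩
    0# ∎

  [q*p]×x≈0 : ∀ q x → (q ℕ.* p) × x ≈ 0#
  [q*p]×x≈0 q x = begin
    (q ℕ.* p) × x  ≡⟨ ≡.cong (_× x) (ℕP.*-comm q p) ⟩
    (p ℕ.* q) × x  ≈⟨ ×-assocˡ x p q ⟨
    p × (q × x)    ≈⟨ p×x≈0 (q × x) ⟩
    0# ∎

  private
    sum-last : ∀ k (t : Vector Carrier (suc k)) → (∀ i → toℕ i < k → t i ≈ 0#) → sum t ≈ t (fromℕ k)
    sum-last zero    t t≈0 = +-identityʳ _
    sum-last (suc k) t t≈0 = trans (+-congʳ (t≈0 Fin.zero (s≤s z≤n)))
      (trans (+-identityˡ _) (sum-last k (tail t) (λ i i<k → t≈0 (Fin.suc i) (s≤s i<k))))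

    sum-ends : ∀ k (t : Vector Carrier (suc (suc k))) →
               (∀ i → 0 < toℕ i → toℕ i < suc k → t i ≈ 0#) → sum t ≈ t Fin.zero + t (fromℕ (suc k))
    sum-ends k t t≈0 = +-congˡ (sum-last k (tail t) (λ i i<k → t≈0 (Fin.suc i) (s≤s z≤n) (s≤s i<k)))

    1^n≈1 : ∀ n → 1# ^ n ≈ 1#
    1^n≈1 zero    = refl
    1^n≈1 (suc n) = trans (*-identityˡ _) (1^n≈1 n)

    0^[1+n]≈0 : ∀ n → 0# ^ suc n ≈ 0#
    0^[1+n]≈0 n = zeroˡ _

    frobenius-+′ : ∀ m → suc m ≡ p → ∀ x y → (x + y) ^ suc m ≈ x ^ suc m + y ^ suc m
    frobenius-+′ m 1+m≡p x y = begin
      (x + y) ^ suc m                       ≈⟨ Binomial.theorem (suc m) x y ⟩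
      Binomial.binomialExpansion x y (suc m)
        ≈⟨ sum-ends m _ middle≈0 ⟩
      Binomial.binomialTerm x y (suc m) Fin.zero + Binomial.binomialTerm x y (suc m) (fromℕ (suc m))
        ≈⟨ +-cong (trans (+-identityʳ _) (*-identityˡ _)) last≈x^p ⟩
      y ^ suc m + x ^ suc m                 ≈⟨ +-comm _ _ ⟩
      x ^ suc m + y ^ suc m ∎
      where
        last≈x^p : Binomial.binomialTerm x y (suc m) (fromℕ (suc m)) ≈ x ^ suc m
        last≈x^p = begin
          (suc m C t) × (x ^ t * y ^ (suc m ∸ t))   ≡⟨ ≡.cong (λ k → (suc m C k) × (x ^ k * y ^ (suc m ∸ k))) t≡1+m ⟩
          (suc m C suc m) × (x ^ suc m * y ^ (m ∸ m)) ≡⟨ ≡.cong₂ (λ a b → a × (x ^ suc m * y ^ b)) (nCn≡1 (suc m)) (ℕP.n∸n≡0 m) ⟩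
          1 × (x ^ suc m * 1#)                       ≈⟨ trans (+-identityʳ _) (*-identityʳ _) ⟩
          x ^ suc m ∎
          where
            t = toℕ (fromℕ (suc m))
            t≡1+m = FinP.toℕ-fromℕ (suc m)
        middle≈0 : ∀ i → 0 < toℕ i → toℕ i < suc m → Binomial.binomialTerm x y (suc m) i ≈ 0#
        middle≈0 i 0<i i<p with prime∣C p-prime (toℕ i) 0<i (≡.subst (toℕ i <_) 1+m≡p i<p)
        ... | divides q C≡q*p = trans (reflexive (≡.cong (_× Binomial.binomial x y (suc m) i) (≡.trans (≡.cong (_C toℕ i) 1+m≡p) C≡q*p)))
                                      ([q*p]×x≈0 q _)

  frobenius-+ : ∀ x y → (x + y) ^ p ≈ x ^ p + y ^ p
  frobenius-+ x y = ≡.subst (λ q → (x + y) ^ q ≈ x ^ q + y ^ q) (ℕP.suc-pred p)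
                            (frobenius-+′ (ℕ.pred p) (ℕP.suc-pred p) x y)

  0^p≈0 : 0# ^ p ≈ 0#
  0^p≈0 = ≡.subst (λ q → 0# ^ q ≈ 0#) (ℕP.suc-pred p) (0^[1+n]≈0 (ℕ.pred p))

  frobenius-additive : Additive (_^ p)
  frobenius-additive = record
    { isMagmaHomomorphism = record { isRelHomomorphism = record { cong = ^-congˡ p } ; homo = frobenius-+ }
    ; ε-homo = 0^p≈0 }

  frobenius^-additive : ∀ r → Additive (_^ (p ℕ.^ r))
  frobenius^-additive r = record
    { isMagmaHomomorphism = record { isRelHomomorphism = record { cong = ^-congˡ (p ℕ.^ r) } ; homo = homo r }
    ; ε-homo = ≡.subst (λ q → 0# ^ q ≈ 0#) (ℕP.suc-pred (p ℕ.^ r) {{ℕP.m^n≢0 p r}}) (0^[1+n]≈0 (ℕ.pred (p ℕ.^ r))) }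
    where
      homo : ∀ r x y → (x + y) ^ (p ℕ.^ r) ≈ x ^ (p ℕ.^ r) + y ^ (p ℕ.^ r)
      homo zero    x y = trans (*-identityʳ _) (sym (+-cong (*-identityʳ x) (*-identityʳ y)))
      homo (suc r) x y = begin
        (x + y) ^ (p ℕ.* p ℕ.^ r)               ≈⟨ ^-assocʳ (x + y) p (p ℕ.^ r) ⟨
        ((x + y) ^ p) ^ (p ℕ.^ r)               ≈⟨ ^-congˡ (p ℕ.^ r) (frobenius-+ x y) ⟩
        (x ^ p + y ^ p) ^ (p ℕ.^ r)             ≈⟨ homo r (x ^ p) (y ^ p) ⟩
        (x ^ p) ^ (p ℕ.^ r) + (y ^ p) ^ (p ℕ.^ r) ≈⟨ +-cong (^-assocʳ x p _) (^-assocʳ y p _) ⟩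
        x ^ (p ℕ.* p ℕ.^ r) + y ^ (p ℕ.* p ℕ.^ r) ∎

  ×1-^p : ∀ k → (k × 1#) ^ p ≈ k × 1#
  ×1-^p k = trans (additive-× frobenius-additive k 1#) (×-congʳ k (1^n≈1 p))

  1<p : 1 < p
  1<p = ℕ.nonTrivial⇒n>1 p {{prime⇒nonTrivial p-prime}}

  ×1-negate : ∀ a → a < p → ∃[ b ] b < p ×ᵖ b × 1# + a × 1# ≈ 0#
  ×1-negate zero    _   = 0 , ℕ.>-nonZero⁻¹ p , +-identityˡ 0#
  ×1-negate (suc a) a<p = p ∸ suc a , ℕP.∸-monoʳ-< {o = 0} (s≤s z≤n) (ℕP.<⇒≤ a<p) , (begin
    (p ∸ suc a) × 1# + suc a × 1#  ≈⟨ ×-homo-+ 1# (p ∸ suc a) (suc a) ⟨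
    (p ∸ suc a ℕ.+ suc a) × 1#     ≡⟨ ≡.cong (_× 1#) (ℕP.m∸n+n≡m (ℕP.<⇒≤ a<p)) ⟩
    p × 1#                         ≈⟨ p×x≈0 1# ⟩
    0# ∎)

  ℘F : Carrier → Carrier
  ℘F x = x ^ p - x

  ℘F-additive : Additive ℘F
  ℘F-additive = additive-- frobenius-additive id-additive

module FieldProperties {c ℓ} (F : CommutativeRing c ℓ) (isField : OverRing.IsField F) where
  open CommutativeRing F
  open OverRing.IsField isField
  open import Algebra.Properties.Ring ring using (x∙y⁻¹≈ε⇒x≈y; [y-z]x≈yx-zx)
  open import Algebra.Properties.CommutativeSemigroup *-commutativeSemigroup using (x∙yz≈y∙xz)
  open import Algebra.Properties.Semiring.Exp semiring using (_^_)
  open import Relation.Binary.Reasoning.Setoid setoid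

  *-nonzero : ∀ {x y} → ¬ x ≈ 0# → ¬ y ≈ 0# → ¬ x * y ≈ 0#
  *-nonzero {x} {y} x≉0 y≉0 xy≈0 with inverse x x≉0 | inverse y y≉0
  ... | x⁻¹ , xx⁻¹≈1 | y⁻¹ , yy⁻¹≈1 = nontrivial (begin
    1#                    ≈⟨ *-identityʳ 1# ⟨
    1# * 1#               ≈⟨ *-cong xx⁻¹≈1 yy⁻¹≈1 ⟨
    (x * x⁻¹) * (y * y⁻¹) ≈⟨ *-assoc x x⁻¹ (y * y⁻¹) ⟩
    x * (x⁻¹ * (y * y⁻¹)) ≈⟨ *-congˡ (x∙yz≈y∙xz x⁻¹ y y⁻¹) ⟩
    x * (y * (x⁻¹ * y⁻¹)) ≈⟨ *-assoc x y _ ⟨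
    (x * y) * (x⁻¹ * y⁻¹) ≈⟨ *-congʳ xy≈0 ⟩
    0# * (x⁻¹ * y⁻¹)      ≈⟨ zeroˡ _ ⟩
    0# ∎)

  ^-nonzero : ∀ {x} m → ¬ x ≈ 0# → ¬ x ^ m ≈ 0#
  ^-nonzero zero    x≉0 = nontrivial
  ^-nonzero (suc m) x≉0 = *-nonzero x≉0 (^-nonzero m x≉0)

  x*y≈0⇒x≈0 : ∀ {x y} → ¬ y ≈ 0# → x * y ≈ 0# → x ≈ 0#
  x*y≈0⇒x≈0 {x} {y} y≉0 xy≈0 with inverse y y≉0
  ... | y⁻¹ , yy⁻¹≈1 = begin
    x                ≈⟨ *-identityʳ x ⟨
    x * 1#           ≈⟨ *-congˡ yy⁻¹≈1 ⟨
    x * (y * y⁻¹)    ≈⟨ *-assoc x y y⁻¹ ⟨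
    (x * y) * y⁻¹    ≈⟨ *-congʳ xy≈0 ⟩
    0# * y⁻¹         ≈⟨ zeroˡ y⁻¹ ⟩
    0# ∎

  *-cancelʳ-nonzero : ∀ {x y z} → ¬ z ≈ 0# → x * z ≈ y * z → x ≈ y
  *-cancelʳ-nonzero {x} {y} {z} z≉0 xz≈yz = x∙y⁻¹≈ε⇒x≈y x y (x*y≈0⇒x≈0 z≉0 (begin
    (x - y) * z      ≈⟨ [y-z]x≈yx-zx z x y ⟩
    x * z - y * z    ≈⟨ +-congʳ xz≈yz ⟩
    y * z - y * z    ≈⟨ -‿inverseʳ (y * z) ⟩
    0# ∎))

  -- (f₀ , … , f_{d-1}) stands for the monic polynomial X^d + f_{d-1} X^{d-1} + ⋯ + f₀
  evalMonic : ∀ {d} → Vec Carrier d → Carrier → Carrier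
  evalMonic []       x = 1#
  evalMonic (a ∷ as) x = x * evalMonic as x + a

  divideByLinear : ∀ {d} → Carrier → Vec Carrier (suc d) → Vec Carrier d ×ᵖ Carrier
  divideByLinear r (a ∷ [])     = [] , r + a
  divideByLinear r (a ∷ b ∷ bs) = (s ∷ q) , r * s + a
    where open Σ (divideByLinear r (b ∷ bs)) renaming (proj₁ to q; proj₂ to s)

  private
    [u-v]+[v+w]≈u+w : ∀ u v w → (u - v) + (v + w) ≈ u + w
    [u-v]+[v+w]≈u+w u v w = begin
      (u - v) + (v + w)     ≈⟨ +-assoc u (- v) (v + w) ⟩
      u + (- v + (v + w))   ≈⟨ +-congˡ (+-assoc (- v) v w) ⟨
      u + ((- v + v) + w)   ≈⟨ +-congˡ (+-congʳ (-‿inverseˡ v)) ⟩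
      u + (0# + w)          ≈⟨ +-congˡ (+-identityˡ w) ⟩
      u + w ∎

  divideByLinear-correct : ∀ {d} r (f : Vec Carrier (suc d)) x →
    let (q , s) = divideByLinear r f in evalMonic f x ≈ (x - r) * evalMonic q x + s
  divideByLinear-correct r (a ∷ []) x = begin
    x * 1# + a               ≈⟨ +-congʳ (*-identityʳ x) ⟩
    x + a                    ≈⟨ [u-v]+[v+w]≈u+w x r a ⟨
    (x - r) + (r + a)        ≈⟨ +-congʳ (*-identityʳ _) ⟨
    (x - r) * 1# + (r + a) ∎
  divideByLinear-correct r (a ∷ b ∷ bs) x = begin
    x * evalMonic (b ∷ bs) x + a                      ≈⟨ +-congʳ (*-congˡ (divideByLinear-correct r (b ∷ bs) x)) ⟩
    x * ((x - r) * Q + s) + a                         ≈⟨ +-congʳ (distribˡ x _ s) ⟩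
    (x * ((x - r) * Q) + x * s) + a                   ≈⟨ +-assoc _ _ a ⟩
    x * ((x - r) * Q) + (x * s + a)                   ≈⟨ +-congˡ ([u-v]+[v+w]≈u+w (x * s) (r * s) a) ⟨
    x * ((x - r) * Q) + ((x * s - r * s) + (r * s + a)) ≈⟨ +-assoc _ _ _ ⟨
    (x * ((x - r) * Q) + (x * s - r * s)) + (r * s + a) ≈⟨ +-congʳ (+-cong (x∙yz≈y∙xz (x - r) x Q) ([y-z]x≈yx-zx s x r)) ⟨
    ((x - r) * (x * Q) + (x - r) * s) + (r * s + a)   ≈⟨ +-congʳ (distribˡ (x - r) _ s) ⟨
    (x - r) * (x * Q + s) + (r * s + a) ∎
    where
      open Σ (divideByLinear r (b ∷ bs)) renaming (proj₁ to q; proj₂ to s)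
      Q = evalMonic q x

  distinct-roots-exhaust : ∀ d (f : Vec Carrier d) (r : ℕ → Carrier) x →
    (∀ i → i < d → evalMonic f (r i) ≈ 0#) →
    (∀ i j → i < d → j < d → r i ≈ r j → i ≡ j) →
    (∀ i → i < d → ¬ x ≈ r i) → ¬ evalMonic f x ≈ 0#
  distinct-roots-exhaust zero    []  r x _ _ _ = nontrivial
  distinct-roots-exhaust (suc d) f r x roots distinct x≉r fx≈0 =
    distinct-roots-exhaust d q (r ∘ suc) x
      (λ i i<d → q-vanishes (r (suc i)) (r[1+i]≉r₀ i i<d) (roots (suc i) (s≤s i<d)))
      (λ i j i<d j<d rᵢ≈rⱼ → ℕP.suc-injective (distinct (suc i) (suc j) (s≤s i<d) (s≤s j<d) rᵢ≈rⱼ))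
      (λ i i<d → x≉r (suc i) (s≤s i<d))
      (q-vanishes x (x≉r 0 (s≤s z≤n)) fx≈0)
    where
      open Σ (divideByLinear (r 0) f) renaming (proj₁ to q; proj₂ to s)
      r[1+i]≉r₀ : ∀ i → i < d → ¬ r (suc i) ≈ r 0
      r[1+i]≉r₀ i i<d eq with distinct (suc i) 0 (s≤s i<d) (s≤s z≤n) eq
      ... | ()
      s≈0 : s ≈ 0#
      s≈0 = begin
        s                                 ≈⟨ +-identityˡ s ⟨
        0# + s                            ≈⟨ +-congʳ (trans (*-congʳ (-‿inverseʳ (r 0))) (zeroˡ _)) ⟨
        (r 0 - r 0) * evalMonic q (r 0) + s ≈⟨ divideByLinear-correct (r 0) f (r 0) ⟨
        evalMonic f (r 0)                 ≈⟨ roots 0 (s≤s z≤n) ⟩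
        0# ∎
      q-vanishes : ∀ y → ¬ y ≈ r 0 → evalMonic f y ≈ 0# → evalMonic q y ≈ 0#
      q-vanishes y y≉r₀ fy≈0 = x*y≈0⇒x≈0 (λ y-r₀≈0 → y≉r₀ (x∙y⁻¹≈ε⇒x≈y y (r 0) y-r₀≈0)) (begin
        evalMonic q y * (y - r 0)        ≈⟨ *-comm _ _ ⟩
        (y - r 0) * evalMonic q y        ≈⟨ +-identityʳ _ ⟨
        (y - r 0) * evalMonic q y + 0#   ≈⟨ +-congˡ s≈0 ⟨
        (y - r 0) * evalMonic q y + s    ≈⟨ divideByLinear-correct (r 0) f y ⟨
        evalMonic f y                    ≈⟨ fy≈0 ⟩
        0# ∎)

module PrimeField {c ℓ} (F : CommutativeRing c ℓ) (isField : OverRing.IsField F)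
                  {p : ℕ} (p-prime : Prime p) (char : OverRing.HasChar F p) where
  open CommutativeRing F
  open OverRing.IsField isField
  open FiniteSums F
  open CharacteristicP F p-prime char
  open FieldProperties F isField
  open import Algebra.Properties.Monoid.Mult +-monoid using (_×_; ×-homo-+; ×-assocˡ; ×-congʳ)
  open import Algebra.Properties.Semiring.Exp semiring using (_^_)
  open import Algebra.Properties.Ring ring using (x∙y⁻¹≈ε⇒x≈y; x≈y⇒x∙y⁻¹≈ε; -‿distribʳ-*; +-cancelˡ)
  open import Relation.Binary.Reasoning.Setoid setoid

  ×1-nonzero : ∀ k → 0 < k → k < p → ¬ k × 1# ≈ 0#
  ×1-nonzero k@(suc _) _ k<p k×1≈0 with Bézout.identity (coprime⇒GCD≡1 (prime⇒coprime p-prime k<p))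
  ... | Bézout.Identity.+- x y 1+y*k≡x*p = nontrivial (begin
    1#                   ≈⟨ 1+[multiple-of-k]≈1 y ⟨
    (1 ℕ.+ y ℕ.* k) × 1# ≡⟨ ≡.cong (_× 1#) 1+y*k≡x*p ⟩
    (x ℕ.* p) × 1#       ≈⟨ [q*p]×x≈0 x 1# ⟩
    0# ∎)
    where
      1+[multiple-of-k]≈1 : ∀ y → (1 ℕ.+ y ℕ.* k) × 1# ≈ 1#
      1+[multiple-of-k]≈1 y = begin
        (1 ℕ.+ y ℕ.* k) × 1#         ≈⟨ ×-homo-+ 1# 1 (y ℕ.* k) ⟩
        1 × 1# + (y ℕ.* k) × 1#      ≈⟨ +-cong (+-identityʳ 1#) (sym (×-assocˡ 1# y k)) ⟩
        1# + y × (k × 1#)            ≈⟨ +-congˡ (trans (×-congʳ y k×1≈0) (×-zeroʳ y)) ⟩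
        1# + 0#                      ≈⟨ +-identityʳ 1# ⟩
        1# ∎
  ... | Bézout.Identity.-+ x y 1+x*p≡y*k = nontrivial (begin
    1#                    ≈⟨ +-identityʳ 1# ⟨
    1# + 0#               ≈⟨ +-cong (sym (+-identityʳ 1#)) (sym ([q*p]×x≈0 x 1#)) ⟩
    1 × 1# + (x ℕ.* p) × 1# ≈⟨ ×-homo-+ 1# 1 (x ℕ.* p) ⟨
    (1 ℕ.+ x ℕ.* p) × 1#  ≡⟨ ≡.cong (_× 1#) 1+x*p≡y*k ⟩
    (y ℕ.* k) × 1#        ≈⟨ ×-assocˡ 1# y k ⟨
    y × (k × 1#)          ≈⟨ ×-congʳ y k×1≈0 ⟩
    y × 0#                ≈⟨ ×-zeroʳ y ⟩
    0# ∎)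

  private
    ×1-distinct : ∀ {a b} → a < b → b < p → ¬ a × 1# ≈ b × 1#
    ×1-distinct {a} {b} a<b b<p a×1≈b×1 =
      ×1-nonzero (b ∸ a) (ℕP.m<n⇒0<n∸m a<b) (ℕP.≤-<-trans (ℕP.m∸n≤m b a) b<p) (+-cancelˡ (a × 1#) _ _ (begin
        a × 1# + (b ∸ a) × 1#   ≈⟨ ×-homo-+ 1# a (b ∸ a) ⟨
        (a ℕ.+ (b ∸ a)) × 1#    ≡⟨ ≡.cong (_× 1#) (ℕP.m+[n∸m]≡n (ℕP.<⇒≤ a<b)) ⟩
        b × 1#                  ≈⟨ a×1≈b×1 ⟨
        a × 1#                  ≈⟨ +-identityʳ _ ⟨
        a × 1# + 0# ∎))

  ×1-injective : ∀ a b → a < p → b < p → a × 1# ≈ b × 1# → a ≡ b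
  ×1-injective a b a<p b<p a×1≈b×1 with ℕP.<-cmp a b
  ... | tri< a<b _ _ = ⊥-elim (×1-distinct a<b b<p a×1≈b×1)
  ... | tri≈ _ a≡b _ = a≡b
  ... | tri> _ _ b<a = ⊥-elim (×1-distinct b<a a<p (sym a×1≈b×1))

  private
    X^[2+m]-X : ∀ m → Vec Carrier (2 ℕ.+ m)
    X^[2+m]-X m = 0# ∷ - 1# ∷ replicate m 0#

    evalMonic-zeros : ∀ m x → evalMonic (replicate m 0#) x ≈ x ^ m
    evalMonic-zeros zero    x = refl
    evalMonic-zeros (suc m) x = trans (+-identityʳ _) (*-congˡ (evalMonic-zeros m x))

    eval-X^[2+m]-X : ∀ m x → evalMonic (X^[2+m]-X m) x ≈ x ^ (2 ℕ.+ m) - x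
    eval-X^[2+m]-X m x = begin
      x * (x * evalMonic (replicate m 0#) x + - 1#) + 0#  ≈⟨ +-identityʳ _ ⟩
      x * (x * evalMonic (replicate m 0#) x + - 1#)       ≈⟨ distribˡ x _ _ ⟩
      x * (x * evalMonic (replicate m 0#) x) + x * - 1#   ≈⟨ +-cong (*-congˡ (*-congˡ (evalMonic-zeros m x))) (sym (-‿distribʳ-* x 1#)) ⟩
      x ^ (2 ℕ.+ m) + - (x * 1#)                          ≈⟨ +-congˡ (-‿cong (*-identityʳ x)) ⟩
      x ^ (2 ℕ.+ m) - x ∎

    frobenius-fixed⇒∈𝔽ₚ′ : ∀ m → 2 ℕ.+ m ≡ p → ∀ x → x ^ p ≈ x → ¬ (∀ a → a < p → ¬ x ≈ a × 1#)
    frobenius-fixed⇒∈𝔽ₚ′ m ≡.refl x x^p≈x x∉𝔽ₚ = distinct-roots-exhaust p (X^[2+m]-X m) (_× 1#) x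
      (λ a _ → trans (eval-X^[2+m]-X m (a × 1#)) (x≈y⇒x∙y⁻¹≈ε (×1-^p a)))
      (λ a b a<p b<p → ×1-injective a b a<p b<p)
      x∉𝔽ₚ
      (trans (eval-X^[2+m]-X m x) (x≈y⇒x∙y⁻¹≈ε x^p≈x))

  -- only ¬¬-membership in 𝔽ₚ can be concluded, as equality in 𝔽 need not be decidable
  frobenius-fixed⇒∈𝔽ₚ : ∀ x → x ^ p ≈ x → ¬ (∀ a → a < p → ¬ x ≈ a × 1#)
  frobenius-fixed⇒∈𝔽ₚ = frobenius-fixed⇒∈𝔽ₚ′ (p ∸ 2) (ℕP.m+[n∸m]≡n 1<p)

  FpIndependent : (ℕ → Carrier) → ℕ → ℕ → Set ℓ
  FpIndependent g a b = ∀ k → (∀ l → a ≤ l → l ≤ b → k l < p) →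
                        lincomb k g a b ≈ 0# → ∀ l → a ≤ l → l ≤ b → k l ≡ 0

  FpIndependent-cong : ∀ {g h a b} → (∀ l → a ≤ l → l ≤ b → g l ≈ h l) → FpIndependent g a b → FpIndependent h a b
  FpIndependent-cong {a = a} {b} g≈h indep k k<p Σkh≈0 =
    indep k k<p (trans (sumF-cong a b (λ l a≤l l≤b → ×-congʳ (k l) (g≈h l a≤l l≤b))) Σkh≈0)

  FpIndependent-*ʳ : ∀ {g a b} c → FpIndependent (λ l → g l * c) a b → FpIndependent g a b
  FpIndependent-*ʳ {g} {a} {b} c indep k k<p Σkg≈0 =
    indep k k<p (trans (sym (additive-lincomb (*-additiveʳ c) k g a b)) (trans (*-congʳ Σkg≈0) (zeroˡ c)))

  independent⇒nonzero : ∀ {g a b} → FpIndependent g a b → ∀ j → a ≤ j → j ≤ b → ¬ g j ≈ 0#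
  independent⇒nonzero {g} {a} {b} indep j a≤j j≤b gj≈0 =
    ℕP.1+n≢0 (≡.trans (≡.sym ([]≔-updated zeros j 1)) (indep δ δ<p δ-comb≈0 j a≤j j≤b))
    where
      zeros : ℕ → ℕ
      zeros _ = 0
      δ = zeros [ j ]≔ 1
      δ<p : ∀ l → a ≤ l → l ≤ b → δ l < p
      δ<p l _ _ with l ℕ.≟ j
      ... | yes _ = 1<p
      ... | no  _ = ℕ.>-nonZero⁻¹ p
      δ-comb≈0 : lincomb δ g a b ≈ 0#
      δ-comb≈0 = begin
        lincomb δ g a b  ≈⟨ sumF-single a b j _ a≤j j≤b (λ l _ _ l≢j → reflexive (≡.cong (_× g l) ([]≔-unchanged zeros 1 l≢j))) ⟩
        δ j × g j        ≡⟨ ≡.cong (_× g j) ([]≔-updated zeros j 1) ⟩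
        g j + 0#         ≈⟨ +-identityʳ (g j) ⟩
        g j              ≈⟨ gj≈0 ⟩
        0# ∎

  -- A relation among the ℘ g_l would make Σ k_l g_l a root of X^p − X, i.e. an element c of 𝔽ₚ,
  -- and then (−c) g_a + Σ k_l g_l = 0 since g_a = 1.
  ℘F-independent : ∀ {g a b} → FpIndependent g a b → g a ≈ 1# → FpIndependent (℘F ∘ g) (suc a) b
  ℘F-independent {g} {a} {b} indep ga≈1 k k<p Σk℘g≈0 l a<l l≤b =
    decidable-stable (k l ℕ.≟ 0) (λ kl≢0 → frobenius-fixed⇒∈𝔽ₚ X X^p≈X (λ c c<p X≈c → kl≢0 (kl≡0 c c<p X≈c)))
    where
      X = lincomb k g (suc a) b
      X^p≈X : X ^ p ≈ X
      X^p≈X = x∙y⁻¹≈ε⇒x≈y _ _ (trans (additive-lincomb ℘F-additive k g (suc a) b) Σk℘g≈0)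
      kl≡0 : ∀ c → c < p → X ≈ c × 1# → k l ≡ 0
      kl≡0 c c<p X≈c with ×1-negate c c<p
      ... | c′ , c′<p , c′+c≈0 =
        ≡.trans (≡.sym ([]≔-unchanged k c′ (ℕP.>⇒≢ a<l))) (indep k′ k′<p k′-comb≈0 l (ℕP.<⇒≤ a<l) l≤b)
        where
          k′ = k [ a ]≔ c′
          k′<p : ∀ m → a ≤ m → m ≤ b → k′ m < p
          k′<p m a≤m m≤b with m ℕ.≟ a
          ... | yes _   = c′<p
          ... | no  m≢a = k<p m (ℕP.≤∧≢⇒< a≤m (m≢a ∘ ≡.sym)) m≤b
          k′-comb≈0 : lincomb k′ g a b ≈ 0#
          k′-comb≈0 = begin
            lincomb k′ g a b                     ≈⟨ sumF-head a b _ (ℕP.≤-trans (ℕP.<⇒≤ a<l) l≤b) ⟩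
            k′ a × g a + lincomb k′ g (suc a) b  ≈⟨ +-cong
                                                      (trans (reflexive (≡.cong (_× g a) ([]≔-updated k a c′))) (×-congʳ c′ ga≈1))
                                                      (sumF-cong (suc a) b (λ m a<m _ → reflexive (≡.cong (_× g m) ([]≔-unchanged k c′ (ℕP.>⇒≢ a<m))))) ⟩
            c′ × 1# + X                          ≈⟨ +-congˡ X≈c ⟩
            c′ × 1# + c × 1#                     ≈⟨ c′+c≈0 ⟩
            0# ∎

module LaurentSeries {c ℓ} (F : CommutativeRing c ℓ) (isField : OverRing.IsField F) where
  open CommutativeRing F
  open OverRing F
  open OverRing.IsField isField
  open FiniteSums F
  open FieldProperties F isField
  open import Algebra.Properties.Monoid.Mult +-monoid using (_×_; ×-congʳ)
  open import Algebra.Properties.Semiring.Exp semiring using (_^_)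
  open import Algebra.Properties.Ring ring using (-0#≈0#)
  open import Relation.Binary.Reasoning.Setoid setoid

  ValAtLeast : K → ℤ → Set ℓ
  ValAtLeast x a = ∀ k → k ℤ.< a → coeff x k ≈ 0#

  coeff-below : ∀ x {k} → k ℤ.< ord x → coeff x k ≡ 0#
  coeff-below x {k} k<o with k ℤ.- ord x in eq
  ... | + n      = ⊥-elim (ℤP.<⇒≱ k<o (ℤP.0≤i-j⇒j≤i (≡.subst (ℤ.+ 0 ℤ.≤_) (≡.sym eq) (ℤ.+≤+ z≤n))))
  ... | -[1+ _ ] = ≡.refl

  coeff-ord+ : ∀ x n → coeff x (ord x ℤ.+ + n) ≡ co x n
  coeff-ord+ x n with (ord x ℤ.+ + n) ℤ.- ord x | ℤsolve 2 (λ o n → (o :+ n) :- o := n) ≡.refl (ord x) (+ n)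
  ... | _ | ≡.refl = ≡.refl

  data Position (x : K) (k : ℤ) : Set where
    below : k ℤ.< ord x → Position x k
    at    : ∀ n → k ≡ ord x ℤ.+ + n → Position x k

  position : ∀ x k → Position x k
  position x k with k ℤ.<? ord x
  ... | yes k<o = below k<o
  ... | no  k≮o = let n , k≡o+n = i≤j⇒j≡i+n (ℤP.≮⇒≥ k≮o) in at n k≡o+n

  ValAtLeast-ord : ∀ x → ValAtLeast x (ord x)
  ValAtLeast-ord x k k<o = reflexive (coeff-below x k<o)

  ValAtLeast-ord+ : ∀ x t → (∀ n → n < t → co x n ≈ 0#) → ValAtLeast x (ord x ℤ.+ + t)
  ValAtLeast-ord+ x t co≈0 k k<o+t with position x k
  ... | below k<o = ValAtLeast-ord x k k<o
  ... | at n ≡.refl with +-cancelˡ-< (ord x) k<o+t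
  ...   | ℤ.+<+ n<t = trans (reflexive (coeff-ord+ x n)) (co≈0 n n<t)

  coeff-+K : ∀ x y k → coeff (x +K y) k ≈ coeff x k + coeff y k
  coeff-+K x y k with position (x +K y) k
  ... | below k<o = begin
    coeff (x +K y) k       ≡⟨ coeff-below (x +K y) k<o ⟩
    0#                     ≈⟨ +-identityʳ 0# ⟨
    0# + 0#                ≡⟨ ≡.cong₂ _+_ (coeff-below x (ℤP.<-≤-trans k<o (ℤP.i⊓j≤i (ord x) (ord y))))
                                          (coeff-below y (ℤP.<-≤-trans k<o (ℤP.i⊓j≤j (ord x) (ord y)))) ⟨
    coeff x k + coeff y k  ∎
  ... | at n ≡.refl = reflexive (coeff-ord+ (x +K y) n)

  coeff--K : ∀ x k → coeff (-K x) k ≈ - coeff x k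
  coeff--K x k with position x k
  ... | below k<o = begin
    coeff (-K x) k  ≡⟨ coeff-below (-K x) k<o ⟩
    0#              ≈⟨ -0#≈0# ⟨
    - 0#            ≡⟨ ≡.cong -_ (coeff-below x k<o) ⟨
    - coeff x k     ∎
  ... | at n ≡.refl = reflexive (≡.trans (coeff-ord+ (-K x) n) (≡.cong -_ (≡.sym (coeff-ord+ x n))))

  coeff-0K : ∀ k → coeff 0K k ≈ 0#
  coeff-0K k with position 0K k
  ... | below k<0 = reflexive (coeff-below 0K k<0)
  ... | at n ≡.refl = reflexive (coeff-ord+ 0K n)

  coeff-·K : ∀ n x k → coeff (n ·K x) k ≈ n × coeff x k
  coeff-·K zero    x k = coeff-0K k
  coeff-·K (suc n) x k = trans (coeff-+K x (n ·K x) k) (+-congˡ (coeff-·K n x k))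

  coeff-sumK : ∀ a b f k → coeff (sumK a b f) k ≈ sumF a b (λ l → coeff (f l) k)
  coeff-sumK a b f k = coeff-foldr (rangeFT a b)
    where
      coeff-foldr : ∀ xs → coeff (foldr _+K_ 0K (map f xs)) k ≈ foldr _+_ 0# (map (λ l → coeff (f l) k) xs)
      coeff-foldr []       = coeff-0K k
      coeff-foldr (l ∷ xs) = trans (coeff-+K (f l) _ k) (+-congˡ (coeff-foldr xs))

  coeff-*K : ∀ x y N → coeff (x *K y) ((ord x ℤ.+ ord y) ℤ.+ + N) ≡
                       ∑ (suc N) (λ i → coeff x (ord x ℤ.+ + i) * coeff y (ord y ℤ.+ + (N ∸ i)))
  coeff-*K x y N = ≡.trans (coeff-ord+ (x *K y) N) (≡.trans (sumF-∑ 0 N _)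
    (∑-cong-≡ (suc N) (λ i → ≡.sym (≡.cong₂ _*_ (coeff-ord+ x i) (coeff-ord+ y (N ∸ i))))))

  module _ {x y a b} (x≥a : ValAtLeast x a) (y≥b : ValAtLeast y b) where

    *-vanishes-< : ∀ u v → u ℤ.+ v ℤ.< a ℤ.+ b → coeff x u * coeff y v ≈ 0#
    *-vanishes-< u v u+v<a+b with i+j<k+l⇒i<k⊎j<l u+v<a+b
    ... | inj₁ u<a = trans (*-congʳ (x≥a u u<a)) (zeroˡ _)
    ... | inj₂ v<b = trans (*-congˡ (y≥b v v<b)) (zeroʳ _)

    *-vanishes-≢ : ∀ u v → u ℤ.+ v ≡ a ℤ.+ b → u ≢ a → coeff x u * coeff y v ≈ 0#
    *-vanishes-≢ u v u+v≡a+b u≢a with ℤP.<-cmp u a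
    ... | tri< u<a _ _ = trans (*-congʳ (x≥a u u<a)) (zeroˡ _)
    ... | tri≈ _ u≡a _ = ⊥-elim (u≢a u≡a)
    ... | tri> _ _ a<u = trans (*-congˡ (y≥b v (i+j≡k+l∧k<i⇒j<l u+v≡a+b a<u))) (zeroʳ _)

    ValAtLeast-*K : ValAtLeast (x *K y) (a ℤ.+ b)
    ValAtLeast-*K k k<a+b with position (x *K y) k
    ... | below k<o = ValAtLeast-ord (x *K y) k k<o
    ... | at N ≡.refl = trans (reflexive (coeff-*K x y N)) (∑-zero (suc N) (λ i i≤N →
          *-vanishes-< (ord x ℤ.+ + i) (ord y ℤ.+ + (N ∸ i)) (≡.subst (ℤ._< a ℤ.+ b) (≡.sym ([i+m]+[j+[n∸m]]≡[i+j]+n (ord x) (ord y) (ℕP.≤-pred i≤N))) k<a+b)))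

    *K-lead : coeff (x *K y) (a ℤ.+ b) ≈ coeff x a * coeff y b
    *K-lead with position (x *K y) (a ℤ.+ b)
    ... | below a+b<o = trans (reflexive (coeff-below (x *K y) a+b<o)) (sym (lead≈0 (i+j<k+l⇒i<k⊎j<l a+b<o)))
      where
        lead≈0 : a ℤ.< ord x ⊎ b ℤ.< ord y → coeff x a * coeff y b ≈ 0#
        lead≈0 (inj₁ a<ox) = trans (*-congʳ (reflexive (coeff-below x a<ox))) (zeroˡ _)
        lead≈0 (inj₂ b<oy) = trans (*-congˡ (reflexive (coeff-below y b<oy))) (zeroʳ _)
    ... | at N a+b≡o+N = trans (reflexive (≡.trans (≡.cong (coeff (x *K y)) a+b≡o+N) (coeff-*K x y N))) lead-term
      where
        ox = ord x
        oy = ord y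
        T : ℕ → Carrier
        T i = coeff x (ox ℤ.+ + i) * coeff y (oy ℤ.+ + (N ∸ i))
        indices : ∀ i → i < suc N → (ox ℤ.+ + i) ℤ.+ (oy ℤ.+ + (N ∸ i)) ≡ a ℤ.+ b
        indices i i≤N = ≡.trans ([i+m]+[j+[n∸m]]≡[i+j]+n ox oy (ℕP.≤-pred i≤N)) (≡.sym a+b≡o+N)
        T≈0 : ∀ i → i < suc N → ox ℤ.+ + i ≢ a → T i ≈ 0#
        T≈0 i i≤N = *-vanishes-≢ (ox ℤ.+ + i) (oy ℤ.+ + (N ∸ i)) (indices i i≤N)
        lead-term : ∑ (suc N) T ≈ coeff x a * coeff y b
        lead-term with position x a
        ... | below a<ox = trans (∑-zero (suc N) {T} (λ i i≤N → T≈0 i i≤N (λ ox+i≡a → ℤP.<⇒≱ a<ox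
                                   (≡.subst (ox ℤ.≤_) ox+i≡a (ℤP.i≤i+j ox (+ i))))))
                                 (sym (trans (*-congʳ (reflexive (coeff-below x a<ox))) (zeroˡ _)))
        ... | at A a≡ox+A with A ℕ.≤? N
        ...   | yes A≤N = trans
                  (∑-single (suc N) {T} A (s≤s A≤N) (λ i i≤N i≢A → T≈0 i i≤N (λ ox+i≡a →
                     i≢A (ℤP.+-injective (+-cancelˡ-≡ ox (≡.trans ox+i≡a a≡ox+A))))))
                  (*-cong (reflexive (≡.cong (coeff x) (≡.sym a≡ox+A))) (reflexive (≡.cong (coeff y) oy+[N-A]≡b)))
          where
            oy+[N-A]≡b : oy ℤ.+ + (N ∸ A) ≡ b
            oy+[N-A]≡b = +-cancelˡ-≡ a (≡.trans (≡.cong (ℤ._+ (oy ℤ.+ + (N ∸ A))) a≡ox+A) (indices A (s≤s A≤N)))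
        ...   | no  A≰N = trans
                  (∑-zero (suc N) {T} (λ i i≤N → T≈0 i i≤N (λ ox+i≡a →
                     ℕP.<⇒≢ (ℕP.≤-<-trans (ℕP.≤-pred i≤N) (ℕP.≰⇒> A≰N)) (ℤP.+-injective (+-cancelˡ-≡ ox (≡.trans ox+i≡a a≡ox+A))))))
                  (sym (trans (*-congˡ (reflexive (coeff-below y b<oy))) (zeroʳ _)))
          where
            ox+N<a : ox ℤ.+ + N ℤ.< a
            ox+N<a = ≡.subst (ox ℤ.+ + N ℤ.<_) (≡.sym a≡ox+A) (ℤP.+-monoʳ-< ox (ℤ.+<+ (ℕP.≰⇒> A≰N)))
            b<oy : b ℤ.< oy
            b<oy = i+j≡k+l∧k<i⇒j<l (≡.trans a+b≡o+N (ℤsolve 3 (λ i j n → (i :+ j) :+ n := (i :+ n) :+ j) ≡.refl ox oy (+ N))) ox+N<a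

  ValAtLeast-powK : ∀ {x a} m → ValAtLeast x a → ValAtLeast (powK x m) (+ m ℤ.* a)
  ValAtLeast-powK zero    x≥a = ValAtLeast-ord 1K
  ValAtLeast-powK {a = a} (suc m) x≥a =
    ≡.subst (ValAtLeast _) (≡.sym (ℤP.suc-* (+ m) a)) (ValAtLeast-*K x≥a (ValAtLeast-powK m x≥a))

  powK-lead : ∀ {x a} m → ValAtLeast x a → coeff (powK x m) (+ m ℤ.* a) ≈ coeff x a ^ m
  powK-lead zero    x≥a = refl
  powK-lead {x} {a} (suc m) x≥a = begin
    coeff (powK x (suc m)) (+ suc m ℤ.* a)        ≡⟨ ≡.cong (coeff (powK x (suc m))) (ℤP.suc-* (+ m) a) ⟩
    coeff (x *K powK x m) (a ℤ.+ + m ℤ.* a)       ≈⟨ *K-lead x≥a (ValAtLeast-powK m x≥a) ⟩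
    coeff x a * coeff (powK x m) (+ m ℤ.* a)      ≈⟨ *-congˡ (powK-lead m x≥a) ⟩
    coeff x a ^ suc m ∎

  HasVal-*K : ∀ {x y a b} → HasVal x a → HasVal y b → HasVal (x *K y) (a ℤ.+ b)
  HasVal-*K (x≥a , xa≉0) (y≥b , yb≉0) =
    ValAtLeast-*K x≥a y≥b , λ lead≈0 → *-nonzero xa≉0 yb≉0 (trans (sym (*K-lead x≥a y≥b)) lead≈0)

  HasVal-powK : ∀ {x a} m → HasVal x a → HasVal (powK x m) (+ m ℤ.* a)
  HasVal-powK m (x≥a , xa≉0) =
    ValAtLeast-powK m x≥a , λ lead≈0 → ^-nonzero m xa≉0 (trans (sym (powK-lead m x≥a)) lead≈0)

  HasVal-≈K : ∀ {x y a} → x ≈K y → HasVal x a → HasVal y a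
  HasVal-≈K {a = a} x≈y (x≥a , xa≉0) = (λ k k<a → trans (sym (x≈y k)) (x≥a k k<a)) , λ ya≈0 → xa≉0 (trans (x≈y a) ya≈0)

  ValAtLeast-induction : ∀ x v → (∀ a → a ℤ.< v → ValAtLeast x a → coeff x a ≈ 0#) → ValAtLeast x v
  ValAtLeast-induction x v step k k<v with position x k
  ... | below k<o   = ValAtLeast-ord x k k<o
  ... | at n ≡.refl = trans (reflexive (coeff-ord+ x n)) (co≈0 n k<v)
    where
      co≈0 : ∀ n → ord x ℤ.+ + n ℤ.< v → co x n ≈ 0#
      co≈0 = <-rec _ λ n rec ox+n<v → trans (reflexive (≡.sym (coeff-ord+ x n)))
        (step _ ox+n<v (ValAtLeast-ord+ x n λ m m<n →
          rec m<n (ℤP.<-trans (ℤP.+-monoʳ-< (ord x) (ℤ.+<+ m<n)) ox+n<v)))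

  HasVal-*K-cancel : ∀ {x Q R q r v} → x *K Q ≈K R → HasVal Q q → HasVal R r → v ℤ.+ q ≡ r →
                     HasVal x v ×ᵖ coeff x v * coeff Q q ≈ coeff R r
  HasVal-*K-cancel {x} {Q} {R} {q} {r} {v} xQ≈R (Q≥q , Qq≉0) (R≥r , Rr≉0) v+q≡r = (x≥v , xv≉0) , lead
    where
      lead-at : ∀ {a} → ValAtLeast x a → coeff x a * coeff Q q ≈ coeff R (a ℤ.+ q)
      lead-at {a} x≥a = trans (sym (*K-lead x≥a Q≥q)) (xQ≈R (a ℤ.+ q))
      x≥v : ValAtLeast x v
      x≥v = ValAtLeast-induction x v λ a a<v x≥a → x*y≈0⇒x≈0 Qq≉0
        (trans (lead-at x≥a) (R≥r _ (≡.subst (a ℤ.+ q ℤ.<_) v+q≡r (ℤP.+-monoˡ-< q a<v))))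
      lead : coeff x v * coeff Q q ≈ coeff R r
      lead = trans (lead-at x≥v) (reflexive (≡.cong (coeff R) v+q≡r))
      xv≉0 : ¬ coeff x v ≈ 0#
      xv≉0 xv≈0 = Rr≉0 (trans (sym lead) (trans (*-congʳ xv≈0) (zeroˡ _)))

  -- Long division of y by z, where v(z) = ord z + d and v(y) > v(z): the quotient
  -- Σ_t u_t t^{1+t} is found coefficient by coefficient.
  module LongDivision (z y : K) (d : ℕ) (z-val : HasVal z (ord z ℤ.+ + d))
                      (y>z : ValAtLeast y (ℤ.suc (ord z ℤ.+ + d))) where
    private
      z-lead≉0 : ¬ co z d ≈ 0#
      z-lead≉0 zd≈0 = proj₂ z-val (trans (reflexive (coeff-ord+ z d)) zd≈0)

      ζ : Carrier
      ζ = proj₁ (inverse (co z d) z-lead≉0)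

      Y : ℕ → Carrier
      Y t = coeff y ((ord z ℤ.+ + 1) ℤ.+ + (d ℕ.+ t))

      Σz·u : ℕ → (ℕ → Carrier) → Carrier
      Σz·u t u = ∑ t (λ j → co z (d ℕ.+ suc j) * u (t ∸ suc j))

      earlier : ∀ {t} → WfRec _<_ (λ _ → Carrier) t → ℕ → Carrier
      earlier {zero}  u j = 0#
      earlier {suc t} u j = u (s≤s (ℕP.m∸n≤m t j))

      next : ∀ t → WfRec _<_ (λ _ → Carrier) t → Carrier
      next t u = ζ * (Y t - ∑ t (λ j → co z (d ℕ.+ suc j) * earlier u j))

      next-ext : ∀ t {u u′ : WfRec _<_ (λ _ → Carrier) t} → (∀ {s} (s<t : s < t) → u s<t ≡ u′ s<t) → next t u ≡ next t u′
      next-ext zero    u≡u′ = ≡.refl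
      next-ext (suc t) u≡u′ = ≡.cong (λ σ → ζ * (Y (suc t) - σ)) (∑-cong-≡ (suc t) λ j → ≡.cong (co z (d ℕ.+ suc j) *_) (u≡u′ (s≤s (ℕP.m∸n≤m t j))))

    u : ℕ → Carrier
    u = WF.All.wfRec <-wellFounded c _ next

    u-unfold : ∀ t → u t ≡ ζ * (Y t - Σz·u t u)
    u-unfold t = ≡.trans (FixPoint.unfold-wfRec <-wellFounded _ next next-ext)
                         (≡.cong (λ σ → ζ * (Y t - σ)) (earlier-u t))
      where
        earlier-u : ∀ t → ∑ t (λ j → co z (d ℕ.+ suc j) * earlier {t} (λ {s} _ → u s) j) ≡ Σz·u t u
        earlier-u zero    = ≡.refl
        earlier-u (suc t) = ≡.refl

    u-step : ∀ t → co z d * u t + Σz·u t u ≈ Y t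
    u-step t = begin
      co z d * u t + Σz·u t u                      ≡⟨ ≡.cong (λ v → co z d * v + Σz·u t u) (u-unfold t) ⟩
      co z d * (ζ * (Y t - Σz·u t u)) + Σz·u t u   ≈⟨ +-congʳ (*-assoc _ _ _) ⟨
      (co z d * ζ) * (Y t - Σz·u t u) + Σz·u t u   ≈⟨ +-congʳ (trans (*-congʳ (proj₂ (inverse (co z d) z-lead≉0))) (*-identityˡ _)) ⟩
      (Y t - Σz·u t u) + Σz·u t u                  ≈⟨ +-assoc _ _ _ ⟩
      Y t + (- Σz·u t u + Σz·u t u)                ≈⟨ +-congˡ (-‿inverseˡ _) ⟩
      Y t + 0#                                     ≈⟨ +-identityʳ _ ⟩
      Y t ∎

    U : K
    U = laurent (+ 1) u

    U∈𝔓 : In𝔓 U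
    U∈𝔓 k k≤0 = reflexive (coeff-below U (ℤP.≤-<-trans k≤0 (ℤ.+<+ (s≤s z≤n))))

    private
      z-low : ∀ i → i < d → co z i ≈ 0#
      z-low i i<d = trans (reflexive (≡.sym (coeff-ord+ z i))) (proj₁ z-val _ (ℤP.+-monoʳ-< (ord z) (ℤ.+<+ i<d)))

      oz+1+N<1+[oz+d] : ∀ {N} → N < d → (ord z ℤ.+ + 1) ℤ.+ + N ℤ.< ℤ.suc (ord z ℤ.+ + d)
      oz+1+N<1+[oz+d] {N} N<d = ≡.subst₂ ℤ._<_
        (ℤsolve 2 (λ o n → con (+ 1) :+ (o :+ n) := (o :+ con (+ 1)) :+ n) ≡.refl (ord z) (+ N)) ≡.refl
        (ℤP.+-monoʳ-< (+ 1) (ℤP.+-monoʳ-< (ord z) (ℤ.+<+ N<d)))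

    y≈zU : y ≈K z *K U
    y≈zU k with position (z *K U) k
    ... | below k<o = trans (y>z k (ℤP.<-≤-trans k<o oz+1≤1+[oz+d])) (sym (reflexive (coeff-below (z *K U) k<o)))
      where
        oz+1≤1+[oz+d] : ord z ℤ.+ + 1 ℤ.≤ ℤ.suc (ord z ℤ.+ + d)
        oz+1≤1+[oz+d] = ℤP.≤-trans (ℤP.≤-reflexive (ℤP.+-comm (ord z) (+ 1))) (ℤP.+-monoʳ-≤ (+ 1) (ℤP.i≤i+j (ord z) (+ d)))
    ... | at N ≡.refl with d ℕ.≤? N
    ...   | no  d≰N = trans (y>z _ (oz+1+N<1+[oz+d] (ℕP.≰⇒> d≰N))) (sym (begin
      coeff (z *K U) ((ord z ℤ.+ + 1) ℤ.+ + N)  ≡⟨ ≡.trans (coeff-ord+ (z *K U) N) (sumF-∑ 0 N _) ⟩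
      ∑ (suc N) (λ i → co z i * u (N ∸ i))      ≈⟨ ∑-zero (suc N) {λ i → co z i * u (N ∸ i)} (λ i i≤N → trans (*-congʳ (z-low i (ℕP.<-≤-trans i≤N (ℕP.≰⇒> d≰N)))) (zeroˡ _)) ⟩
      0# ∎))
    ...   | yes d≤N with ℕP.m≤n⇒∃[o]m+o≡n d≤N
    ...     | t , ≡.refl = sym (begin
      coeff (z *K U) ((ord z ℤ.+ + 1) ℤ.+ + (d ℕ.+ t))  ≡⟨ ≡.trans (coeff-ord+ (z *K U) (d ℕ.+ t)) (sumF-∑ 0 (d ℕ.+ t) _) ⟩
      ∑ (suc (d ℕ.+ t)) T                              ≡⟨ ≡.cong (λ n → ∑ n T) (≡.sym (ℕP.+-suc d t)) ⟩
      ∑ (d ℕ.+ suc t) T                                ≈⟨ ∑-+-split d (suc t) T ⟩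
      ∑ d T + ∑ (suc t) (λ j → T (d ℕ.+ j))            ≈⟨ +-congʳ (∑-zero d {T} (λ i i<d → trans (*-congʳ (z-low i i<d)) (zeroˡ _))) ⟩
      0# + ∑ (suc t) (λ j → T (d ℕ.+ j))               ≈⟨ +-identityˡ _ ⟩
      T (d ℕ.+ 0) + ∑ t (λ j → T (d ℕ.+ suc j))        ≈⟨ +-cong (*-cong (reflexive (≡.cong (co z) (ℕP.+-identityʳ d))) (reflexive (≡.cong u (shift 0))))
                                                               (∑-cong t (λ j _ → *-congˡ (reflexive (≡.cong u (shift (suc j)))))) ⟩
      co z d * u t + Σz·u t u                          ≈⟨ u-step t ⟩
      Y t ∎)
      where
        T : ℕ → Carrier
        T i = co z i * u ((d ℕ.+ t) ∸ i)
        shift : ∀ j → (d ℕ.+ t) ∸ (d ℕ.+ j) ≡ t ∸ j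
        shift j = ℕP.[m+n]∸[m+o]≡n∸o d t j

  coeff-lincombK : ∀ (k : ℕ → ℕ) (f : ℕ → K) a b j → coeff (sumK a b (λ l → k l ·K f l)) j ≈ lincomb k (λ l → coeff (f l) j) a b
  coeff-lincombK k f a b j = trans (coeff-sumK a b (λ l → k l ·K f l) j) (sumF-cong a b (λ l _ _ → coeff-·K (k l) (f l) j))

  ValAtLeast-lincombK : ∀ (k : ℕ → ℕ) (f : ℕ → K) a b m → (∀ l → a ≤ l → l ≤ b → ValAtLeast (f l) m) →
                        lincomb k (λ l → coeff (f l) m) a b ≈ 0# → ValAtLeast (sumK a b (λ l → k l ·K f l)) (ℤ.suc m)
  ValAtLeast-lincombK k f a b m f≥m Σ≈0 j j<1+m = trans (coeff-lincombK k f a b j) (Σ≈0′ (ℤP.<-cmp j m))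
    where
      Σ≈0′ : Tri (j ℤ.< m) (j ≡ m) (m ℤ.< j) → lincomb k (λ l → coeff (f l) j) a b ≈ 0#
      Σ≈0′ (tri< j<m _ _) = sumF-zero a b {λ l → k l × coeff (f l) j} (λ l a≤l l≤b → trans (×-congʳ (k l) (f≥m l a≤l l≤b j j<m)) (×-zeroʳ (k l)))
      Σ≈0′ (tri≈ _ ≡.refl _) = Σ≈0
      Σ≈0′ (tri> _ _ m<j) = ⊥-elim (ℤP.<⇒≱ m<j (<-suc⇒≤ j<1+m))

  InMul𝔓-intro : ∀ z y m → HasVal z m → ValAtLeast y (ℤ.suc m) → InMul𝔓 z y
  InMul𝔓-intro z y m z-val y>z with position z m
  ... | below m<oz  = ⊥-elim (proj₂ z-val (reflexive (coeff-below z m<oz)))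
  ... | at d ≡.refl = U , U∈𝔓 , y≈zU
    where open LongDivision z y d z-val y>z

module ArtinSchreier {c ℓ} (F : CommutativeRing c ℓ) (isField : OverRing.IsField F)
                     {p : ℕ} (p-prime : Prime p) (char : OverRing.HasChar F p) where
  open CommutativeRing F
  open OverRing F
  open CharacteristicP F p-prime char
  open LaurentSeries F isField
  open FieldProperties F isField
  open import Algebra.Properties.Semiring.Exp semiring using (_^_)
  open import Algebra.Properties.Ring ring using (-0#≈0#)
  open import Relation.Binary.Reasoning.Setoid setoid

  private
    coeff-℘ : ∀ x k → coeff x k ≈ 0# → coeff (℘ p x) k ≈ coeff (powK x p) k
    coeff-℘ x k xk≈0 = begin
      coeff (℘ p x) k                       ≈⟨ coeff-+K (powK x p) (-K x) k ⟩
      coeff (powK x p) k + coeff (-K x) k   ≈⟨ +-congˡ (trans (coeff--K x k) (trans (-‿cong xk≈0) -0#≈0#)) ⟩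
      coeff (powK x p) k + 0#               ≈⟨ +-identityʳ _ ⟩
      coeff (powK x p) k ∎

    p*a<a : ∀ a → a ℤ.< + 0 → + p ℤ.* a ℤ.< a
    p*a<a (+ _)    (ℤ.+<+ ())
    p*a<a -[1+ m ] _ = ≡.subst (+ p ℤ.* -[1+ m ] ℤ.<_) (ℤP.*-identityˡ -[1+ m ]) (ℤP.*-monoʳ-<-neg -[1+ m ] (ℤ.+<+ 1<p))

  -- on negative valuations ℘ is dominated by its p-th power term
  HasVal-℘-negative : ∀ {x a} → HasVal x a → a ℤ.< + 0 →
                      HasVal (℘ p x) (+ p ℤ.* a) ×ᵖ coeff (℘ p x) (+ p ℤ.* a) ≈ coeff x a ^ p
  HasVal-℘-negative {x} {a} (x≥a , xa≉0) a<0 = (℘x≥pa , λ lead≈0 → ^-nonzero p xa≉0 (trans (sym lead) lead≈0)) , lead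
    where
      below-a : ∀ k → k ℤ.≤ + p ℤ.* a → coeff x k ≈ 0#
      below-a k k≤pa = x≥a k (ℤP.≤-<-trans k≤pa (p*a<a a a<0))
      ℘x≥pa : ValAtLeast (℘ p x) (+ p ℤ.* a)
      ℘x≥pa k k<pa = trans (coeff-℘ x k (below-a k (ℤP.<⇒≤ k<pa))) (ValAtLeast-powK p x≥a k k<pa)
      lead : coeff (℘ p x) (+ p ℤ.* a) ≈ coeff x a ^ p
      lead = trans (coeff-℘ x (+ p ℤ.* a) (below-a _ ℤP.≤-refl)) (powK-lead p x≥a)

  ℘-integral : ∀ {x} → ValAtLeast x (+ 0) → ValAtLeast (℘ p x) (+ 0) ×ᵖ coeff (℘ p x) (+ 0) ≈ ℘F (coeff x (+ 0))
  ℘-integral {x} x≥0 = ℘x≥0 , lead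
    where
      p*0≡0 : + p ℤ.* + 0 ≡ + 0
      p*0≡0 = ℤP.*-zeroʳ (+ p)
      xᵖ≥0 : ValAtLeast (powK x p) (+ 0)
      xᵖ≥0 = ≡.subst (ValAtLeast (powK x p)) p*0≡0 (ValAtLeast-powK p x≥0)
      ℘x≥0 : ValAtLeast (℘ p x) (+ 0)
      ℘x≥0 k k<0 = trans (coeff-℘ x k (x≥0 k k<0)) (xᵖ≥0 k k<0)
      lead : coeff (℘ p x) (+ 0) ≈ ℘F (coeff x (+ 0))
      lead = trans (coeff-+K (powK x p) (-K x) (+ 0)) (+-cong
        (trans (reflexive (≡.cong (coeff (powK x p)) (≡.sym p*0≡0))) (powK-lead p x≥0)) (coeff--K x (+ 0)))

module Recursion {c ℓ} (F : CommutativeRing c ℓ) where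
  open CommutativeRing F
  open OverRing F

  module Assumptions
    (isField : IsField) {p : ℕ} (p-prime : Prime p) (char : HasChar p)
    (β : K) (b : ℕ) (β-val : HasVal β (ℤ.- (+ b)))
    (n : ℕ) (Ω : ℕ → K) (w : ℕ → ℤ) (Ω-val : ∀ k → k ≤ n → HasVal (Ω k) (w k))
    (Ω₀≈1 : Ω 0 ≈K 1K) (w₀≡0 : w 0 ≡ + 0)
    (w-step : ∀ k → 1 ≤ k → k ≤ n → w k ℤ.≤ w (k ∸ 1))
    (residue : ∀ i j → i < j → j ≤ n → (∀ l → i ≤ l → l ≤ j → w l ≡ w i) →
                 ∀ (a : ℕ → ℕ) → (∀ l → i ≤ l → l ≤ j → a l < p) →
                 InMul𝔓 (φ^ p n (Ω i) *K β) (sumK i j (λ l → a l ·K (φ^ p n (Ω l) *K β))) →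
                 ∀ l → i ≤ l → l ≤ j → a l ≡ 0)
    (W : ℕ → ℕ → K) (W₀≈Ω : ∀ j → j ≤ n → W 0 j ≈K Ω j)
    (W-rec : ∀ i j → 1 ≤ i → i ≤ j → j ≤ n → W i j *K ℘ p (W (i ∸ 1) i) ≈K ℘ p (W (i ∸ 1) j))
    where

    open FiniteSums F
    open CharacteristicP F p-prime char
    open FieldProperties F isField
    open PrimeField F isField p-prime char
    open LaurentSeries F isField
    open ArtinSchreier F isField p-prime char
    open MonoidMorphisms +-rawMonoid +-rawMonoid using (module IsMonoidHomomorphism)
    open import Algebra.Properties.Monoid.Mult +-monoid using (_×_; ×-congʳ)
    open import Algebra.Properties.Semiring.Exp semiring using (_^_; ^-congˡ; ^-congʳ; ^-assocʳ)
    open import Algebra.Properties.CommutativeSemiring.Exp commutativeSemiring using (^-distrib-*)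
    open import Algebra.Properties.CommutativeSemigroup *-commutativeSemigroup using (xy∙z≈xz∙y)
    open import Relation.Binary.Reasoning.Setoid setoid

    p^ : ℕ → ℕ
    p^ i = p ℕ.^ i

    -- the valuation of Ω_j^{(i)} = W i j, as established by the invariant below
    val : ℕ → ℕ → ℤ
    val i j = + p^ i ℤ.* (w j ℤ.- w i)

    lead : ℕ → ℕ → Carrier
    lead i j = coeff (W i j) (val i j)

    ω : ℕ → Carrier
    ω l = coeff (Ω l) (w l)

    w-antitone : ∀ {i j} → i ≤ j → j ≤ n → w j ℤ.≤ w i
    w-antitone {i} {zero}  z≤n    _     = ℤP.≤-refl
    w-antitone {i} {suc j} i≤1+j 1+j≤n with ℕP.m≤n⇒m<n∨m≡n i≤1+j
    ... | inj₂ ≡.refl = ℤP.≤-refl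
    ... | inj₁ i<1+j  = ℤP.≤-trans (w-step (suc j) (s≤s z≤n) 1+j≤n)
                                   (w-antitone {i} {j} (ℕP.≤-pred i<1+j) (ℕP.≤-trans (ℕP.n≤1+n j) 1+j≤n))

    w-constant-between : ∀ {i l e} → i ≤ l → l ≤ e → e ≤ n → w e ≡ w i → w l ≡ w i
    w-constant-between {i} {l} i≤l l≤e e≤n we≡wi =
      ℤP.≤-antisym (w-antitone i≤l (ℕP.≤-trans l≤e e≤n)) (≡.subst (ℤ._≤ w l) we≡wi (w-antitone l≤e e≤n))

    -- l lies in a block of equal valuations that begins at or after i
    Fresh : ℕ → ℕ → Set
    Fresh zero    l = ⊤
    Fresh (suc i) l = w l ℤ.< w i

    fresh : ∀ {i l} → i ≤ n → w l ℤ.< w i → Fresh i l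
    fresh {zero}  _     _     = tt
    fresh {suc i} 1+i≤n wl<wi = ℤP.<-≤-trans wl<wi (w-step (suc i) (s≤s z≤n) 1+i≤n)

    record Invariant (i : ℕ) : Set (c ⊔ ℓ) where
      field
        W-val       : ∀ j → i ≤ j → j ≤ n → HasVal (W i j) (val i j)
        lead-diag   : lead i i ≈ 1#
        lead-ratio  : ∀ l l′ → i ≤ l → l ≤ n → i ≤ l′ → l′ ≤ n → w l ≡ w l′ → Fresh i l →
                      lead i l * ω l′ ^ p^ i ≈ lead i l′ * ω l ^ p^ i
        independent : ∀ e → i < e → e ≤ n → w e ≡ w i → FpIndependent (lead i) i e

    -- The leading coefficient of φ^n(Ω_l) β is ω_l^{p^n} times that of β, so a relation among the
    -- ω_l^{p^n} would put Σ a_l φ^n(Ω_l) β into φ^n(Ω_s) β 𝔓_K.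
    residue-independent : ∀ s e → s < e → e ≤ n → w e ≡ w s → FpIndependent (λ l → ω l ^ p^ n) s e
    residue-independent s e s<e e≤n we≡ws a a<p Σa·ω^pⁿ≈0 =
      residue s e s<e e≤n same-w a a<p (InMul𝔓-intro (T s) Y (m s) (T-val s s≤n) Y>m)
      where
        s≤n = ℕP.≤-trans (ℕP.<⇒≤ s<e) e≤n
        l≤n : ∀ {l} → l ≤ e → l ≤ n
        l≤n l≤e = ℕP.≤-trans l≤e e≤n
        same-w : ∀ l → s ≤ l → l ≤ e → w l ≡ w s
        same-w l s≤l l≤e = w-constant-between s≤l l≤e e≤n we≡ws
        T : ℕ → K
        T l = φ^ p n (Ω l) *K β
        m : ℕ → ℤ
        m l = + p^ n ℤ.* w l ℤ.+ ℤ.- (+ b)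
        m-const : ∀ l → s ≤ l → l ≤ e → m l ≡ m s
        m-const l s≤l l≤e = ≡.cong (λ v → + p^ n ℤ.* v ℤ.+ ℤ.- (+ b)) (same-w l s≤l l≤e)
        lcβ : Carrier
        lcβ = coeff β (ℤ.- (+ b))
        T-val : ∀ l → l ≤ n → HasVal (T l) (m l)
        T-val l l≤n = HasVal-*K (HasVal-powK (p^ n) (Ω-val l l≤n)) β-val
        T-lead : ∀ l → l ≤ n → coeff (T l) (m l) ≈ ω l ^ p^ n * lcβ
        T-lead l l≤n = trans (*K-lead (ValAtLeast-powK (p^ n) Ω≥) (proj₁ β-val)) (*-congʳ (powK-lead (p^ n) Ω≥))
          where Ω≥ = proj₁ (Ω-val l l≤n)
        Y : K
        Y = sumK s e (λ l → a l ·K T l)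
        Y>m : ValAtLeast Y (ℤ.suc (m s))
        Y>m = ValAtLeast-lincombK a T s e (m s)
          (λ l s≤l l≤e → ≡.subst (ValAtLeast (T l)) (m-const l s≤l l≤e) (proj₁ (T-val l (l≤n l≤e))))
          (begin
            lincomb a (λ l → coeff (T l) (m s)) s e      ≈⟨ sumF-cong s e (λ l s≤l l≤e → ×-congʳ (a l)
                                                              (trans (reflexive (≡.cong (coeff (T l)) (≡.sym (m-const l s≤l l≤e)))) (T-lead l (l≤n l≤e)))) ⟩
            lincomb a (λ l → ω l ^ p^ n * lcβ) s e       ≈⟨ additive-lincomb (*-additiveʳ lcβ) a _ s e ⟨
            lincomb a (λ l → ω l ^ p^ n) s e * lcβ       ≈⟨ *-congʳ Σa·ω^pⁿ≈0 ⟩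
            0# * lcβ                                     ≈⟨ zeroˡ lcβ ⟩
            0# ∎)

    -- On a block starting at s the leading coefficients are proportional to the ω_l^{p^s}, and
    -- the Frobenius power p^{n-s} carries a relation among them to one among the ω_l^{p^n}.
    block-independent : ∀ s → s ≤ n → (∀ l → s ≤ l → l ≤ n → w l ≡ w s → lead s l * ω s ^ p^ s ≈ ω l ^ p^ s) →
                        ∀ e → s < e → e ≤ n → w e ≡ w s → FpIndependent (lead s) s e
    block-independent s s≤n lead-prop e s<e e≤n we≡ws a a<p Σa·lead≈0 =
      residue-independent s e s<e e≤n we≡ws a a<p Σa·ω^pⁿ≈0
      where
        same-w : ∀ l → s ≤ l → l ≤ e → w l ≡ w s
        same-w l s≤l l≤e = w-constant-between s≤l l≤e e≤n we≡ws
        ω^pⁿ : ∀ l → ω l ^ p^ n ≈ (ω l ^ p^ s) ^ p^ (n ∸ s)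
        ω^pⁿ l = sym (trans (^-assocʳ (ω l) (p^ s) (p^ (n ∸ s))) (^-congʳ (ω l)
                   (≡.trans (≡.sym (ℕP.^-distribˡ-+-* p s (n ∸ s))) (≡.cong (p ℕ.^_) (ℕP.m+[n∸m]≡n s≤n)))))
        Σa·ω^pˢ≈0 : lincomb a (λ l → ω l ^ p^ s) s e ≈ 0#
        Σa·ω^pˢ≈0 = begin
          lincomb a (λ l → ω l ^ p^ s) s e            ≈⟨ sumF-cong s e (λ l s≤l l≤e → ×-congʳ (a l)
                                                           (sym (lead-prop l s≤l (ℕP.≤-trans l≤e e≤n) (same-w l s≤l l≤e)))) ⟩
          lincomb a (λ l → lead s l * ω s ^ p^ s) s e ≈⟨ additive-lincomb (*-additiveʳ (ω s ^ p^ s)) a (lead s) s e ⟨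
          lincomb a (lead s) s e * ω s ^ p^ s         ≈⟨ *-congʳ Σa·lead≈0 ⟩
          0# * ω s ^ p^ s                             ≈⟨ zeroˡ _ ⟩
          0# ∎
        Σa·ω^pⁿ≈0 : lincomb a (λ l → ω l ^ p^ n) s e ≈ 0#
        Σa·ω^pⁿ≈0 = begin
          lincomb a (λ l → ω l ^ p^ n) s e                  ≈⟨ sumF-cong s e (λ l _ _ → ×-congʳ (a l) (ω^pⁿ l)) ⟩
          lincomb a (λ l → (ω l ^ p^ s) ^ p^ (n ∸ s)) s e   ≈⟨ additive-lincomb (frobenius^-additive (n ∸ s)) a _ s e ⟨
          (lincomb a (λ l → ω l ^ p^ s) s e) ^ p^ (n ∸ s)   ≈⟨ ^-congˡ (p^ (n ∸ s)) Σa·ω^pˢ≈0 ⟩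
          0# ^ p^ (n ∸ s)                                   ≈⟨ IsMonoidHomomorphism.ε-homo (frobenius^-additive (n ∸ s)) ⟩
          0# ∎

    val-step : ∀ i j → val (suc i) j ℤ.+ + p ℤ.* val i (suc i) ≡ + p ℤ.* val i j
    val-step i j = ≡.trans (≡.cong (λ q → q ℤ.* (w j ℤ.- w (suc i)) ℤ.+ + p ℤ.* val i (suc i)) (ℤP.pos-* p (p^ i)))
      (ℤsolve 5 (λ P Q a b c → (P :* Q) :* (a :- b) :+ P :* (Q :* (b :- c)) := P :* (Q :* (a :- c))) ≡.refl
         (+ p) (+ p^ i) (w j) (w (suc i)) (w i))

    val<0 : ∀ i j → w j ℤ.< w i → val i j ℤ.< + 0
    val<0 i j wj<wi = +k*x<0 (p^ i) (ℕP.m^n>0 p i) (≡.subst (w j ℤ.- w i ℤ.<_) (ℤP.+-inverseʳ (w i)) (ℤP.+-monoˡ-< (ℤ.- w i) wj<wi))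
      where
        +k*x<0 : ∀ k {x} → 0 < k → x ℤ.< + 0 → + k ℤ.* x ℤ.< + 0
        +k*x<0 (suc k) { -[1+ _ ]} _ _         = ℤ.-<+
        +k*x<0 (suc k) {+ _}      _ (ℤ.+<+ ())

    val≡0 : ∀ i j → w j ≡ w i → val i j ≡ + 0
    val≡0 i j wj≡wi = ≡.trans (≡.cong (λ v → + p^ i ℤ.* (v ℤ.- w i)) wj≡wi)
                              (≡.trans (≡.cong (+ p^ i ℤ.*_) (ℤP.+-inverseʳ (w i))) (ℤP.*-zeroʳ (+ p^ i)))

    module Step (i : ℕ) (1+i≤n : suc i ≤ n) (inv : Invariant i) where
      open Invariant inv

      ℘W : ℕ → K
      ℘W j = ℘ p (W i j)

      ℘W-negative : ∀ j → i < j → j ≤ n → w j ℤ.< w i →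
                    HasVal (℘W j) (+ p ℤ.* val i j) ×ᵖ coeff (℘W j) (+ p ℤ.* val i j) ≈ lead i j ^ p
      ℘W-negative j i<j j≤n wj<wi = HasVal-℘-negative (W-val j (ℕP.<⇒≤ i<j) j≤n) (val<0 i j wj<wi)

      ℘W-unit : ∀ j → i < j → j ≤ n → w j ≡ w i →
                HasVal (℘W j) (+ p ℤ.* val i j) ×ᵖ coeff (℘W j) (+ p ℤ.* val i j) ≈ ℘F (lead i j)
      ℘W-unit j i<j j≤n wj≡wi = (℘W≥ , λ lead≈0 → ℘lead≉0 (trans (sym ℘W-lead) lead≈0)) , ℘W-lead
        where
          v≡0 : val i j ≡ + 0
          v≡0 = val≡0 i j wj≡wi
          pv≡0 : + p ℤ.* val i j ≡ + 0
          pv≡0 = ≡.trans (≡.cong (+ p ℤ.*_) v≡0) (ℤP.*-zeroʳ (+ p))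
          integral = ℘-integral (≡.subst (ValAtLeast (W i j)) v≡0 (proj₁ (W-val j (ℕP.<⇒≤ i<j) j≤n)))
          ℘W≥ : ValAtLeast (℘W j) (+ p ℤ.* val i j)
          ℘W≥ = ≡.subst (ValAtLeast (℘W j)) (≡.sym pv≡0) (proj₁ integral)
          ℘W-lead : coeff (℘W j) (+ p ℤ.* val i j) ≈ ℘F (lead i j)
          ℘W-lead = trans (reflexive (≡.cong (coeff (℘W j)) pv≡0))
                          (trans (proj₂ integral) (IsMonoidHomomorphism.⟦⟧-cong ℘F-additive (reflexive (≡.cong (coeff (W i j)) (≡.sym v≡0)))))
          ℘lead≉0 : ¬ ℘F (lead i j) ≈ 0#
          ℘lead≉0 = independent⇒nonzero (℘F-independent (independent j i<j j≤n wj≡wi) lead-diag) j i<j ℕP.≤-refl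

      w≡ : ∀ j → i ≤ j → j ≤ n → ¬ w j ℤ.< w i → w j ≡ w i
      w≡ j i≤j j≤n wj≮wi = ℤP.≤-antisym (w-antitone i≤j j≤n) (ℤP.≮⇒≥ wj≮wi)

      ℘W-val : ∀ j → i < j → j ≤ n → HasVal (℘W j) (+ p ℤ.* val i j)
      ℘W-val j i<j j≤n with w j ℤ.<? w i
      ... | yes wj<wi = proj₁ (℘W-negative j i<j j≤n wj<wi)
      ... | no  wj≮wi = proj₁ (℘W-unit j i<j j≤n (w≡ j (ℕP.<⇒≤ i<j) j≤n wj≮wi))

      γ : Carrier
      γ = coeff (℘W (suc i)) (+ p ℤ.* val i (suc i))

      γ≉0 : ¬ γ ≈ 0#
      γ≉0 = proj₂ (℘W-val (suc i) ℕP.≤-refl 1+i≤n)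

      W-val′ : ∀ j → i < j → j ≤ n →
               HasVal (W (suc i) j) (val (suc i) j) ×ᵖ lead (suc i) j * γ ≈ coeff (℘W j) (+ p ℤ.* val i j)
      W-val′ j i<j j≤n = HasVal-*K-cancel (W-rec (suc i) j (s≤s z≤n) i<j j≤n)
                           (℘W-val (suc i) ℕP.≤-refl 1+i≤n) (℘W-val j i<j j≤n) (val-step i j)

      lead-diag′ : lead (suc i) (suc i) ≈ 1#
      lead-diag′ = *-cancelʳ-nonzero γ≉0 (trans (proj₂ (W-val′ (suc i) ℕP.≤-refl 1+i≤n)) (sym (*-identityˡ γ)))

      lead-negative : ∀ l → i < l → l ≤ n → w l ℤ.< w i → lead (suc i) l * γ ≈ lead i l ^ p
      lead-negative l i<l l≤n wl<wi = trans (proj₂ (W-val′ l i<l l≤n)) (proj₂ (℘W-negative l i<l l≤n wl<wi))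

      lead-ratio′ : ∀ l l′ → suc i ≤ l → l ≤ n → suc i ≤ l′ → l′ ≤ n → w l ≡ w l′ → w l ℤ.< w i →
                    lead (suc i) l * ω l′ ^ p^ (suc i) ≈ lead (suc i) l′ * ω l ^ p^ (suc i)
      lead-ratio′ l l′ i<l l≤n i<l′ l′≤n wl≡wl′ wl<wi = *-cancelʳ-nonzero γ≉0 (begin
        (lead (suc i) l * ω l′ ^ p^ (suc i)) * γ   ≈⟨ xy∙z≈xz∙y _ _ _ ⟩
        (lead (suc i) l * γ) * ω l′ ^ p^ (suc i)   ≈⟨ *-cong (lead-negative l i<l l≤n wl<wi) (^p^[1+i] (ω l′)) ⟩
        lead i l ^ p * (ω l′ ^ p^ i) ^ p           ≈⟨ ^-distrib-* _ _ p ⟨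
        (lead i l * ω l′ ^ p^ i) ^ p               ≈⟨ ^-congˡ p (lead-ratio l l′ (ℕP.<⇒≤ i<l) l≤n (ℕP.<⇒≤ i<l′) l′≤n wl≡wl′ (fresh i≤n wl<wi)) ⟩
        (lead i l′ * ω l ^ p^ i) ^ p               ≈⟨ ^-distrib-* _ _ p ⟩
        lead i l′ ^ p * (ω l ^ p^ i) ^ p           ≈⟨ *-cong (lead-negative l′ i<l′ l′≤n (≡.subst (ℤ._< w i) wl≡wl′ wl<wi)) (^p^[1+i] (ω l)) ⟨
        (lead (suc i) l′ * γ) * ω l ^ p^ (suc i)   ≈⟨ xy∙z≈xz∙y _ _ _ ⟩
        (lead (suc i) l′ * ω l ^ p^ (suc i)) * γ   ∎)
        where
          i≤n = ℕP.≤-trans (ℕP.n≤1+n i) 1+i≤n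
          ^p^[1+i] : ∀ x → x ^ p^ (suc i) ≈ (x ^ p^ i) ^ p
          ^p^[1+i] x = sym (trans (^-assocʳ x (p^ i) p) (^-congʳ x (ℕP.*-comm (p^ i) p)))

      independent′ : ∀ e → suc i < e → e ≤ n → w e ≡ w (suc i) → FpIndependent (lead (suc i)) (suc i) e
      independent′ e 1+i<e e≤n we≡w[1+i] with w (suc i) ℤ.<? w i
      ... | yes new-block = block-independent (suc i) 1+i≤n lead-prop e 1+i<e e≤n we≡w[1+i]
        where
          lead-prop : ∀ l → suc i ≤ l → l ≤ n → w l ≡ w (suc i) → lead (suc i) l * ω (suc i) ^ p^ (suc i) ≈ ω l ^ p^ (suc i)
          lead-prop l i<l l≤n wl≡w[1+i] =
            trans (lead-ratio′ l (suc i) i<l l≤n ℕP.≤-refl 1+i≤n wl≡w[1+i] (≡.subst (ℤ._< w i) (≡.sym wl≡w[1+i]) new-block))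
                  (trans (*-congʳ lead-diag′) (*-identityˡ _))
      ... | no  same-block = FpIndependent-*ʳ γ (FpIndependent-cong lead-unit
                               (℘F-independent (independent e (ℕP.<-trans (ℕP.n<1+n i) 1+i<e) e≤n we≡wi) lead-diag))
        where
          we≡wi : w e ≡ w i
          we≡wi = ≡.trans we≡w[1+i] (w≡ (suc i) (ℕP.n≤1+n i) 1+i≤n same-block)
          lead-unit : ∀ l → suc i ≤ l → l ≤ e → ℘F (lead i l) ≈ lead (suc i) l * γ
          lead-unit l i<l l≤e = sym (trans (proj₂ (W-val′ l i<l l≤n)) (proj₂ (℘W-unit l i<l l≤n
                                  (w-constant-between (ℕP.<⇒≤ i<l) l≤e e≤n we≡wi))))
            where l≤n = ℕP.≤-trans l≤e e≤n

      invariant : Invariant (suc i)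
      invariant = record
        { W-val       = λ j i<j j≤n → proj₁ (W-val′ j i<j j≤n)
        ; lead-diag   = lead-diag′
        ; lead-ratio  = lead-ratio′
        ; independent = independent′
        }

    val₀ : ∀ j → val 0 j ≡ w j
    val₀ j = ≡.trans (ℤP.*-identityˡ (w j ℤ.- w 0)) (≡.trans (≡.cong (ℤ._-_ (w j)) w₀≡0) (ℤP.+-identityʳ (w j)))

    lead₀ : ∀ l → l ≤ n → lead 0 l ≈ ω l
    lead₀ l l≤n = trans (reflexive (≡.cong (coeff (W 0 l)) (val₀ l))) (W₀≈Ω l l≤n (w l))

    ω₀≈1 : ω 0 ≈ 1#
    ω₀≈1 = trans (Ω₀≈1 (w 0)) (reflexive (≡.cong (coeff 1K) w₀≡0))

    invariant₀ : Invariant 0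
    invariant₀ = record
      { W-val       = λ j _ j≤n → ≡.subst (HasVal (W 0 j)) (≡.sym (val₀ j))
                                          (HasVal-≈K (λ k → sym (W₀≈Ω j j≤n k)) (Ω-val j j≤n))
      ; lead-diag   = trans (lead₀ 0 z≤n) ω₀≈1
      ; lead-ratio  = λ l l′ _ l≤n _ l′≤n _ _ → begin
          lead 0 l * (ω l′ * 1#)   ≈⟨ *-cong (lead₀ l l≤n) (*-identityʳ _) ⟩
          ω l * ω l′               ≈⟨ *-comm _ _ ⟩
          ω l′ * ω l               ≈⟨ *-cong (lead₀ l′ l′≤n) (*-identityʳ _) ⟨
          lead 0 l′ * (ω l * 1#)   ∎
      ; independent = block-independent 0 z≤n λ l _ l≤n _ →
          trans (*-cong (lead₀ l l≤n) (trans (*-identityʳ _) ω₀≈1)) (trans (*-identityʳ _) (sym (*-identityʳ _)))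
      }

    invariant : ∀ i → i ≤ n → Invariant i
    invariant zero    _     = invariant₀
    invariant (suc i) 1+i≤n = Step.invariant i 1+i≤n (invariant i (ℕP.≤-trans (ℕP.n≤1+n i) 1+i≤n))

    val-formula : ∀ i j → i ≤ j → val i j ≡ ℤ.- (+ p^ i) ℤ.* sumℤ (suc i) j (λ k → w (k ∸ 1) ℤ.- w k)
    val-formula i j i≤j = ≡.sym (≡.trans (≡.cong (ℤ.- (+ p^ i) ℤ.*_) (sumℤ-telescope w i≤j))
      (ℤsolve 3 (λ P a b → (:- P) :* (a :- b) := P :* (b :- a)) ≡.refl (+ p^ i) (w i) (w j)))


lemma4p1 :
  ∀ {c ℓ : Level} (p : ℕ) → Prime p →
  (F : CommutativeRing c ℓ) →
  let open CommutativeRing F using (Carrier)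
      open OverRing F
  in IsField → HasChar p → (IsFinite ⊎ IsAlgClosureOfFp p) →
  -- β ∈ K with v_K(β) = -b, b > 0, gcd(b,p) = 1
  (β : K) (b : ℕ) → 0 < b → gcd b p ≡ 1 → HasVal β (ℤ.- (+ b)) →
  -- Ω_0, …, Ω_n ∈ K with valuations w_k = v_K(Ω_k)
  (n : ℕ) (Ω : ℕ → K) (w : ℕ → ℤ) →
  (∀ k → k ≤ n → HasVal (Ω k) (w k)) →
  -- Ω_0, …, Ω_n linearly independent over F_p
  (∀ (a : ℕ → ℕ) → (∀ l → l ≤ n → a l < p) →
     sumK 0 n (λ l → a l ·K Ω l) ≈K 0K → ∀ l → l ≤ n → a l ≡ 0) →
  -- Ω_0 = 1
  Ω 0 ≈K 1K →
  -- v_K(Ω_n) ≤ ⋯ ≤ v_K(Ω_1) ≤ v_K(Ω_0) = 0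
  w 0 ≡ + 0 →
  (∀ k → 1 ≤ k → k ≤ n → w k ℤ.≤ w (k ∸ 1)) →
  -- residue condition: if v_K(Ω_i) = ⋯ = v_K(Ω_j), i < j, the images of
  -- φ^n(Ω_i)β, …, φ^n(Ω_j)β in φ^n(Ω_i)β𝔒_K / φ^n(Ω_i)β𝔓_K are F_p-independent
  (∀ i j → i < j → j ≤ n → (∀ l → i ≤ l → l ≤ j → w l ≡ w i) →
     ∀ (a : ℕ → ℕ) → (∀ l → i ≤ l → l ≤ j → a l < p) →
     InMul𝔓 (φ^ p n (Ω i) *K β)
            (sumK i j (λ l → a l ·K (φ^ p n (Ω l) *K β))) →
     ∀ l → i ≤ l → l ≤ j → a l ≡ 0) →
  -- Ω_j^{(i)} = W i j :  Ω_j^{(0)} = Ω_j,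
  -- Ω_j^{(i)} = ℘(Ω_j^{(i-1)}) / ℘(Ω_i^{(i-1)})  for 1 ≤ i ≤ j ≤ n
  (W : ℕ → ℕ → K) →
  (∀ j → j ≤ n → W 0 j ≈K Ω j) →
  (∀ i j → 1 ≤ i → i ≤ j → j ≤ n →
     W i j *K ℘ p (W (i ∸ 1) i) ≈K ℘ p (W (i ∸ 1) j)) →
  -- conclusion
  ∀ i j → i < j → j ≤ n →
    HasVal (W i j)
      (ℤ.- (+ (p ℕ.^ i)) ℤ.* sumℤ (suc i) j (λ k → w (k ∸ 1) ℤ.- w k))
lemma4p1 p p-prime F isField char _ β b _ _ β-val n Ω w Ω-val _ Ω₀≈1 w₀≡0 w-step residue W W₀≈Ω W-rec i j i<j j≤n =
  ≡.subst (HasVal (W i j)) (val-formula i j i≤j) (Invariant.W-val (invariant i i≤n) j i≤j j≤n)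
  where
    open OverRing F using (HasVal)
    open Recursion.Assumptions F isField p-prime char β b β-val n Ω w Ω-val Ω₀≈1 w₀≡0 w-step residue W W₀≈Ω W-rec
    i≤j = ℕP.<⇒≤ i<j
    i≤n = ℕP.≤-trans i≤j j≤n
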